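{- Let $n\ge1$, and let $t>0$ and $R\ge1$ be such that $t$ and $2nR$ are integers. Assume $x\in\mathbb{Z}_{\mathcal O}^n$ satisfies $\lambda_1(g_tu_x\mathbb{F}_q[X]^{n+1})\ge e^{ -R}$. Then there exists a rational point $v\in\mathbb{F}_q(X)^n$ such that \[ e^{nt-R}\le H(v)\le e^{n(t+2nR)}\quad\text{and}\quad d(x,v)\le\tfrac12 e^{ -(n+1)t}. \]
   Context: Let $\mathcal{K}=\mathbb{F}_q((X^{ -1}))$ with the absolute value determined by $|f/g|=e^{\deg f-\deg g}$ for nonzero $f,g\in\mathbb{F}_q[X]$, and $\mathbb{Z}_{\mathcal O}=\{x\in\mathcal{K}:|x|\le1\}$. On $\mathcal{K}^m$ use the sup norm $\|w\|=\max_i|w_i|$ and $d(x,y)=\|x-y\|$. For $x=(x_1,\dots,x_n)\in\mathcal{K}^n$, $u_x$ is the $(n+1)\times(n+1)$ unipotent lower-triangular matrix with $1$ on the diagonal, entries $-x_1,\dots,-x_n$ in the first column below the diagonal, and $0$ elsewhere; for $t\in\mathbb{Z}$, $g_t=\mathrm{diag}(X^{ -nt},X^t,\dots,X^t)$. For a lattice $\Lambda$, $\lambda_1(\Lambda)=\inf\{\|w\|:w\in\Lambda\setminus\{0\}\}$. A rational point $v=(f_1/g,\dots,f_n/g)\in\mathbb{F}_q(X)^n$ corresponds to $\mathbf{v}=(g,f_1,\dots,f_n)\in\mathbb{F}_q[X]^{n+1}$, with height $H(v)=\max\{|g|,|f_1|,\dots,|f_n|\}$. -}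

module Defs where

open import Level using (0ℓ)
open import Data.Nat as ℕ using (ℕ; zero; suc; _∸_)
open import Data.Integer as ℤ using (ℤ; +_)
open import Data.Fin as Fin using (Fin)
open import Data.List using (List; []; _∷_)
open import Data.Product using (Σ; ∃; _×_)
open import Relation.Nullary using (¬_; yes; no)
open import Relation.Binary.PropositionalEquality using (_≡_; _≢_)
open import Relation.Binary.Definitions using (DecidableEquality)
open import Algebra.Structures using (IsCommutativeRing)
open import Function.Bundles using (_↔_)

record FiniteField : Set₁ where
  field
    F          : Set
    0#         : F
    1#         : F
    _+F_       : F → F → F
    _*F_       : F → F → F
    -F_        : F → F
    isCommRing : IsCommutativeRing _≡_ _+F_ _*F_ -F_ 0# 1#
    0≢1        : 0# ≢ 1#
    inverse    : ∀ x → x ≢ 0# → Σ F (λ y → y *F x ≡ 1#)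
    _≟F_       : DecidableEquality F
    q          : ℕ
    enum       : F ↔ Fin q

module Over (𝔽 : FiniteField) where
  open FiniteField 𝔽

  -- An element  Σ_{j ≥ 0} c j · X^(top - j)  of 𝒦.
  record K : Set where
    constructor mkK
    field
      top : ℤ
      c   : ℕ → F
  open K public

  coeff : K → ℤ → F
  coeff a k with k ℤ.≤? top a
  ... | yes _ = c a ℤ.∣ top a ℤ.- k ∣
  ... | no  _ = 0#

  _≈K_ : K → K → Set
  a ≈K b = ∀ k → coeff a k ≡ coeff b k

  0K : K
  0K = mkK (+ 0) (λ _ → 0#)

  constK : F → K
  constK a = mkK (+ 0) λ { zero → a ; (suc _) → 0# }

  Xpow : ℤ → K
  Xpow m = mkK m λ { zero → 1# ; (suc _) → 0# }

  _+K_ : K → K → K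
  a +K b = mkK N (λ j → coeff a (N ℤ.- + j) +F coeff b (N ℤ.- + j))
    where N = top a ℤ.⊔ top b

  -K_ : K → K
  -K a = mkK (top a) (λ j → -F (c a j))

  _-K_ : K → K → K
  a -K b = a +K (-K b)

  sumUpTo : (ℕ → F) → ℕ → F
  sumUpTo f zero    = f zero
  sumUpTo f (suc m) = sumUpTo f m +F f (suc m)

  _*K_ : K → K → K
  a *K b = mkK (top a ℤ.+ top b)
               (λ m → sumUpTo (λ j → c a j *F c b (m ∸ j)) m)

  -- polynomials in 𝔽_q[X]: coefficient lists, lowest degree first
  Poly : Set
  Poly = List F

  toK : Poly → K
  toK []      = 0K
  toK (a ∷ p) = constK a +K (Xpow (+ 1) *K toK p)

  _∣P_ : Poly → Poly → Set
  h ∣P g = ∃ λ (k : Poly) → (toK k *K toK h) ≈K toK g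

  -- Comparisons of |a| (|a| = e^(largest k with nonzero coefficient),
  -- |0| = 0) with e^(num/den), den > 0.

  -- |a| ≤ e^(num/den)
  AbsLe : K → ℤ → ℤ → Set
  AbsLe a num den = ∀ k → num ℤ.< den ℤ.* k → coeff a k ≡ 0#

  -- |a| ≥ e^(num/den)
  AbsGe : K → ℤ → ℤ → Set
  AbsGe a num den = ∃ λ k → (coeff a k ≢ 0#) × (num ℤ.≤ den ℤ.* k)

  -- |a| ≤ (1/2)·e^m  (m ∈ ℤ).  Since |a| ∈ {0} ∪ e^ℤ and 0 < log 2 < 1,
  -- this holds iff every nonzero coefficient of a sits in degree < m.
  AbsLeHalfExp : K → ℤ → Set
  AbsLeHalfExp a m = ∀ k → m ℤ.≤ k → coeff a k ≡ 0#

  -- The lattice g_t u_x 𝔽_q[X]^(n+1): image of p = (p₀,…,pₙ) is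
  --   (X^(-n t) p₀ , X^t (p₁ - x₁ p₀) , … , X^t (pₙ - xₙ p₀)).

  latticeVec : (n t : ℕ) → (Fin n → K) → (Fin (suc n) → Poly) → Fin (suc n) → K
  latticeVec n t x p Fin.zero    = Xpow (ℤ.- (+ (n ℕ.* t))) *K toK (p Fin.zero)
  latticeVec n t x p (Fin.suc i) =
    Xpow (+ t) *K (toK (p (Fin.suc i)) -K (x i *K toK (p Fin.zero)))

-- Dirichlet's box principle over 𝔽_q. Put T = t + M. Among the q^(nT+1) polynomials g of degree
-- at most nT, two agree in the coefficients of X⁻¹, …, X⁻ᵀ of every g xᵢ, so a nonzero g has
-- |g xᵢ - fᵢ| < e^(-T), where fᵢ is the polynomial part of g xᵢ; take such a g of least degree.
-- A common factor h of g and the fᵢ with |h| > 1 would give a solution of smaller degree, so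
-- (g, f) is primitive. The last n coordinates Xᵗ (fᵢ - xᵢ g) of g_t u_x (g, f) have size
-- < e^(-M) ≤ e^(-R), so the hypothesis is witnessed by the first one, X^(-nt) g, which gives
-- |g| ≥ e^(nt - R). Hence deg g ≥ nt - M, and v = f/g satisfies
-- |xᵢ - vᵢ| = |xᵢ g - fᵢ| / |g| < e^(-T - deg g) ≤ ½ e^(-(n+1)t).

module Submission where

open import Defs
open import Level using (0ℓ)
open import Data.Nat as ℕ using (ℕ; zero; suc; _∸_; z≤n; s≤s)
import Data.Nat.Properties as ℕP
open import Data.Integer as ℤ using (ℤ; +_; -[1+_])
import Data.Integer.Properties as ℤP
open import Data.Integer.Tactic.RingSolver using (solve-∀)
open import Data.Product using (∃; _×_; _,_; proj₁; proj₂)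
open import Data.Sum using (_⊎_; inj₁; inj₂)
open import Data.Empty using (⊥-elim)
open import Relation.Nullary using (¬_; ¬?; Dec; yes; no)
open import Relation.Binary.PropositionalEquality
  using (_≡_; _≢_; refl; sym; trans; cong; cong₂; subst; _≗_; module ≡-Reasoning)
open import Algebra.Bundles using (CommutativeRing)
open import Relation.Binary.Bundles using (Setoid)
open import Relation.Binary.Structures using (IsEquivalence)
open import Function using (_∘_; case_of_)
open import Function.Bundles using (Inverse)
open import Data.Fin as Fin using (Fin)
import Data.Fin.Properties as FinP
open import Data.List using ([]; _∷_; tabulate; length)
import Data.List.Properties as ListP
open import Relation.Nullary.Decidable using (_×-dec_)

private
  a-[a-b]≡b : ∀ (a b : ℤ) → a ℤ.- (a ℤ.- b) ≡ b
  a-[a-b]≡b = solve-∀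

  a+[b-a]≡b : ∀ (a b : ℤ) → a ℤ.+ (b ℤ.- a) ≡ b
  a+[b-a]≡b = solve-∀

  [a-b]+b≡a : ∀ (a b : ℤ) → (a ℤ.- b) ℤ.+ b ≡ a
  [a-b]+b≡a = solve-∀

  ≤⇒≡+offset : ∀ {i j} → i ℤ.≤ j → ∃ λ p → j ≡ i ℤ.+ + p
  ≤⇒≡+offset {i} {j} i≤j = ℤ.∣ j ℤ.- i ∣ ,
    sym (trans (cong (λ z → i ℤ.+ z) (ℤP.0≤i⇒+∣i∣≡i (ℤP.i≤j⇒0≤j-i i≤j))) (a+[b-a]≡b i j))

  a+[1+b]≡1+[a+b] : ∀ (a b : ℤ) → a ℤ.+ (+ 1 ℤ.+ b) ≡ + 1 ℤ.+ (a ℤ.+ b)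
  a+[1+b]≡1+[a+b] = solve-∀

  a*b-a*c≡a*[b-c] : ∀ (a b c : ℤ) → a ℤ.* b ℤ.- a ℤ.* c ≡ a ℤ.* (b ℤ.- c)
  a*b-a*c≡a*[b-c] = solve-∀

  [a+b]-b≡a : ∀ (a b : ℤ) → a ℤ.+ b ℤ.- b ≡ a
  [a+b]-b≡a = solve-∀

  a+[b-c]≡a+b-c : ∀ (a b c : ℤ) → a ℤ.+ (b ℤ.- c) ≡ a ℤ.+ b ℤ.- c
  a+[b-c]≡a+b-c = solve-∀

  2n*nt : ∀ n t → + (2 ℕ.* n ℕ.* n ℕ.* t) ≡ + (2 ℕ.* n) ℤ.* + (n ℕ.* t)
  2n*nt n t = trans (cong +_ (ℕP.*-assoc (2 ℕ.* n) n t)) (ℤP.pos-* (2 ℕ.* n) (n ℕ.* t))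

  1+a≡a+1-0 : ∀ (a : ℤ) → + 1 ℤ.+ a ≡ a ℤ.+ + 1 ℤ.- + 0
  1+a≡a+1-0 = solve-∀

  a+1-[1+b]≡a-b : ∀ (a b : ℤ) → a ℤ.+ + 1 ℤ.- (+ 1 ℤ.+ b) ≡ a ℤ.- b
  a+1-[1+b]≡a-b = solve-∀

  a+[1+b]≡a+b+1 : ∀ (a b : ℤ) → a ℤ.+ (+ 1 ℤ.+ b) ≡ a ℤ.+ b ℤ.+ + 1
  a+[1+b]≡a+b+1 = solve-∀

  a+[1+b]+c≡a+b+c+1 : ∀ (a b c : ℤ) → a ℤ.+ (+ 1 ℤ.+ b) ℤ.+ c ≡ a ℤ.+ b ℤ.+ c ℤ.+ + 1
  a+[1+b]+c≡a+b+c+1 = solve-∀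

  a+[b+[1+c]]≡a+[b+c]+1 : ∀ (a b c : ℤ) → a ℤ.+ (b ℤ.+ (+ 1 ℤ.+ c)) ≡ a ℤ.+ (b ℤ.+ c) ℤ.+ + 1
  a+[b+[1+c]]≡a+[b+c]+1 = solve-∀

  above-or-below : ∀ N k → N ℤ.< k ⊎ ∃ λ j → k ≡ N ℤ.- + j
  above-or-below N k with k ℤ.≤? N
  ... | no  k≰N = inj₁ (ℤP.≰⇒> k≰N)
  ... | yes k≤N = inj₂ (ℤ.∣ N ℤ.- k ∣ ,
    sym (trans (cong (λ z → N ℤ.- z) (ℤP.0≤i⇒+∣i∣≡i (ℤP.i≤j⇒0≤j-i k≤N))) (a-[a-b]≡b N k)))

least-below : ∀ {P : ℕ → Set} → (∀ d → Dec (P d)) → ∀ N →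
  (∀ d → d ℕ.< N → ¬ P d) ⊎ ∃ λ d → d ℕ.< N × P d × (∀ d' → d' ℕ.< d → ¬ P d')
least-below P? zero = inj₁ λ _ ()
least-below P? (suc N) with least-below P? N
... | inj₂ (d , d<N , pd , below) = inj₂ (d , ℕP.m<n⇒m<1+n d<N , pd , below)
... | inj₁ none<N with P? N
...   | yes pN = inj₂ (N , ℕP.n<1+n N , pN , none<N)
...   | no ¬pN = inj₁ λ d d<1+N → case ℕP.m<1+n⇒m<n∨m≡n d<1+N of λ where
        (inj₁ d<N)  → none<N d d<N
        (inj₂ refl) → ¬pN

least-witness : ∀ {P : ℕ → Set} → (∀ d → Dec (P d)) → ∀ {N} → P N →
  ∃ λ d → d ℕ.≤ N × P d × (∀ d' → d' ℕ.< d → ¬ P d')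
least-witness P? {N} pN with least-below P? N
... | inj₁ none<N                 = N , ℕP.≤-refl , pN , none<N
... | inj₂ (d , d<N , pd , below) = d , ℕP.<⇒≤ d<N , pd , below

module Laurent (𝔽 : FiniteField) where
  open FiniteField 𝔽 using (F; 0#; 1#; 0≢1; isCommRing; inverse; _≟F_; q; enum)
  open Over 𝔽

  F-ring : CommutativeRing 0ℓ 0ℓ
  F-ring = record { isCommutativeRing = isCommRing }

  open CommutativeRing F-ring using (_+_; _*_; -_; +-commutativeSemigroup; ring)
  open import Algebra.Properties.CommutativeSemigroup +-commutativeSemigroup using (interchange)
  open import Algebra.Properties.Ring ring
    using (-0#≈0#; -‿+-comm; x∙y⁻¹≈ε⇒x≈y; ⁻¹-anti-homo‿-; -‿distribˡ-*; -‿distribʳ-*)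
  module FR = CommutativeRing F-ring
  open ≡-Reasoning

  0≡0-0 : 0# ≡ 0# + - 0#
  0≡0-0 = sym (trans (cong (λ z → 0# + z) -0#≈0#) (FR.+-identityʳ 0#))

  -- Finite sums and Cauchy products

  sum-cong≤ : ∀ {f g} m → (∀ j → j ℕ.≤ m → f j ≡ g j) → sumUpTo f m ≡ sumUpTo g m
  sum-cong≤ zero    f≡g = f≡g 0 z≤n
  sum-cong≤ (suc m) f≡g =
    cong₂ _+_ (sum-cong≤ m λ j j≤m → f≡g j (ℕP.m≤n⇒m≤1+n j≤m)) (f≡g (suc m) ℕP.≤-refl)

  sum-cong : ∀ {f g} m → (∀ j → f j ≡ g j) → sumUpTo f m ≡ sumUpTo g m
  sum-cong m f≡g = sum-cong≤ m λ j _ → f≡g j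

  sum-zero : ∀ {f} m → (∀ j → j ℕ.≤ m → f j ≡ 0#) → sumUpTo f m ≡ 0#
  sum-zero {f} m f≡0 = trans (sum-cong≤ m f≡0) (sum-0 m)
    where
    sum-0 : ∀ m → sumUpTo (λ _ → 0#) m ≡ 0#
    sum-0 zero    = refl
    sum-0 (suc m) = trans (cong (_+ 0#) (sum-0 m)) (FR.+-identityʳ 0#)

  sum-+ : ∀ f g m → sumUpTo (λ j → f j + g j) m ≡ sumUpTo f m + sumUpTo g m
  sum-+ f g zero    = refl
  sum-+ f g (suc m) = trans (cong (_+ (f (suc m) + g (suc m))) (sum-+ f g m)) (interchange _ _ _ _)

  sum-neg : ∀ f m → sumUpTo (λ j → - f j) m ≡ - sumUpTo f m
  sum-neg f zero    = refl
  sum-neg f (suc m) = trans (cong (_+ - f (suc m)) (sum-neg f m)) (-‿+-comm _ _)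

  sum-*ˡ : ∀ a f m → a * sumUpTo f m ≡ sumUpTo (λ j → a * f j) m
  sum-*ˡ a f zero    = refl
  sum-*ˡ a f (suc m) = trans (FR.distribˡ a _ _) (cong (_+ a * f (suc m)) (sum-*ˡ a f m))

  sum-*ʳ : ∀ a f m → sumUpTo f m * a ≡ sumUpTo (λ j → f j * a) m
  sum-*ʳ a f m = trans (FR.*-comm _ a) (trans (sum-*ˡ a f m) (sum-cong m λ j → FR.*-comm a (f j)))

  sum-suc : ∀ f m → sumUpTo f (suc m) ≡ f 0 + sumUpTo (f ∘ suc) m
  sum-suc f zero    = refl
  sum-suc f (suc m) = trans (cong (_+ f (suc (suc m))) (sum-suc f m)) (FR.+-assoc _ _ _)

  sum-reverse : ∀ f m → sumUpTo f m ≡ sumUpTo (λ j → f (m ∸ j)) m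
  sum-reverse f zero    = refl
  sum-reverse f (suc m) = begin
    sumUpTo f m + f (suc m)                       ≡⟨ cong (_+ f (suc m)) (sum-reverse f m) ⟩
    sumUpTo (λ j → f (m ∸ j)) m + f (suc m)       ≡⟨ FR.+-comm _ _ ⟩
    f (suc m) + sumUpTo (λ j → f (m ∸ j)) m       ≡⟨ sum-suc (λ j → f (suc m ∸ j)) m ⟨
    sumUpTo (λ j → f (suc m ∸ j)) (suc m)         ∎

  sum-triangle : ∀ (G : ℕ → ℕ → F) m →
    sumUpTo (λ j → sumUpTo (λ i → G i j) j) m ≡
    sumUpTo (λ i → sumUpTo (λ l → G i (i ℕ.+ l)) (m ∸ i)) m
  sum-triangle G zero    = refl
  sum-triangle G (suc m) = begin
    sumUpTo (λ j → sumUpTo (λ i → G i j) j) m + sumUpTo (λ i → G i (suc m)) (suc m)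
      ≡⟨ cong (_+ sumUpTo (λ i → G i (suc m)) (suc m)) (sum-triangle G m) ⟩
    Rows m + (sumUpTo (λ i → G i (suc m)) m + G (suc m) (suc m))
      ≡⟨ FR.+-assoc _ _ _ ⟨
    (Rows m + sumUpTo (λ i → G i (suc m)) m) + G (suc m) (suc m)
      ≡⟨ cong₂ _+_ (sum-+ (Row m) (λ i → G i (suc m)) m) (cong (G (suc m)) (ℕP.+-identityʳ (suc m))) ⟨
    sumUpTo (λ i → Row m i + G i (suc m)) m + G (suc m) (suc m ℕ.+ 0)
      ≡⟨ cong₂ _+_ (sum-cong≤ m λ i i≤m → sym (row-suc i i≤m))
                   (cong (sumUpTo (λ l → G (suc m) (suc m ℕ.+ l))) (ℕP.n∸n≡0 m)) ⟨
    Rows (suc m) ∎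
    where
    Row : ℕ → ℕ → F
    Row m i = sumUpTo (λ l → G i (i ℕ.+ l)) (m ∸ i)
    Rows : ℕ → F
    Rows m = sumUpTo (Row m) m
    row-suc : ∀ i → i ℕ.≤ m → Row m i + G i (suc m) ≡ Row (suc m) i
    row-suc i i≤m rewrite ℕP.+-∸-assoc 1 i≤m =
      cong (λ z → Row m i + z) (cong (G i) (sym (trans (ℕP.+-suc i (m ∸ i)) (cong suc (ℕP.m+[n∸m]≡n i≤m)))))

  infixl 7 _⋆_
  _⋆_ : (ℕ → F) → (ℕ → F) → ℕ → F
  (a ⋆ b) m = sumUpTo (λ j → a j * b (m ∸ j)) m

  ⋆-cong : ∀ {a a' b b'} → a ≗ a' → b ≗ b' → a ⋆ b ≗ a' ⋆ b'
  ⋆-cong a≗a' b≗b' m = sum-cong m λ j → cong₂ _*_ (a≗a' j) (b≗b' (m ∸ j))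

  ⋆-comm : ∀ a b → a ⋆ b ≗ b ⋆ a
  ⋆-comm a b m = trans (sum-reverse _ m) (sum-cong≤ m λ j j≤m →
    trans (FR.*-comm _ _) (cong (λ i → b i * a (m ∸ j)) (ℕP.m∸[m∸n]≡n j≤m)))

  ⋆-assoc : ∀ a b c → (a ⋆ b) ⋆ c ≗ a ⋆ (b ⋆ c)
  ⋆-assoc a b c m = begin
    sumUpTo (λ j → (a ⋆ b) j * c (m ∸ j)) m
      ≡⟨ sum-cong m (λ j → sum-*ʳ (c (m ∸ j)) _ j) ⟩
    sumUpTo (λ j → sumUpTo (λ i → (a i * b (j ∸ i)) * c (m ∸ j)) j) m
      ≡⟨ sum-triangle (λ i j → (a i * b (j ∸ i)) * c (m ∸ j)) m ⟩
    sumUpTo (λ i → sumUpTo (λ l → (a i * b ((i ℕ.+ l) ∸ i)) * c (m ∸ (i ℕ.+ l))) (m ∸ i)) m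
      ≡⟨ sum-cong m (λ i → sum-cong (m ∸ i) λ l → trans (FR.*-assoc _ _ _)
           (cong₂ (λ u v → a i * (b u * c v)) (ℕP.m+n∸m≡n i l) (sym (ℕP.∸-+-assoc m i l)))) ⟩
    sumUpTo (λ i → sumUpTo (λ l → a i * (b l * c ((m ∸ i) ∸ l))) (m ∸ i)) m
      ≡⟨ sum-cong m (λ i → sum-*ˡ (a i) _ (m ∸ i)) ⟨
    (a ⋆ (b ⋆ c)) m ∎

  ⋆-distribˡ-+ : ∀ a b c → a ⋆ (λ j → b j + c j) ≗ λ m → (a ⋆ b) m + (a ⋆ c) m
  ⋆-distribˡ-+ a b c m = trans (sum-cong m λ j → FR.distribˡ _ _ _) (sum-+ _ _ m)

  ⋆-negˡ : ∀ a b → (λ j → - a j) ⋆ b ≗ λ m → - (a ⋆ b) m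
  ⋆-negˡ a b m = trans (sum-cong m λ j → sym (-‿distribˡ-* _ _)) (sum-neg _ m)

  ⋆-zeroˡ : ∀ b → (λ _ → 0#) ⋆ b ≗ λ _ → 0#
  ⋆-zeroˡ b m = sum-zero m λ j _ → FR.zeroˡ _

  δ : ℕ → F
  δ zero    = 1#
  δ (suc _) = 0#

  ⋆-identityˡ : ∀ b → δ ⋆ b ≗ b
  ⋆-identityˡ b zero    = FR.*-identityˡ _
  ⋆-identityˡ b (suc m) = begin
    (δ ⋆ b) (suc m)                                ≡⟨ sum-suc _ m ⟩
    1# * b (suc m) + sumUpTo (λ j → 0# * b (m ∸ j)) m
      ≡⟨ cong₂ _+_ (FR.*-identityˡ _) (sum-zero m λ j _ → FR.zeroˡ _) ⟩
    b (suc m) + 0#                                 ≡⟨ FR.+-identityʳ _ ⟩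
    b (suc m)                                      ∎

  delay : (ℕ → F) → ℕ → F
  delay s zero    = 0#
  delay s (suc j) = s j

  delay-cong : ∀ {a b} → a ≗ b → delay a ≗ delay b
  delay-cong a≗b zero    = refl
  delay-cong a≗b (suc j) = a≗b j

  ⋆-delayˡ : ∀ a b → delay a ⋆ b ≗ delay (a ⋆ b)
  ⋆-delayˡ a b zero    = FR.zeroˡ _
  ⋆-delayˡ a b (suc m) = trans (sum-suc _ m) (trans (cong (_+ (a ⋆ b) m) (FR.zeroˡ _)) (FR.+-identityˡ _))

  ⋆-delayʳ : ∀ a b → a ⋆ delay b ≗ delay (a ⋆ b)
  ⋆-delayʳ a b m = begin
    (a ⋆ delay b) m   ≡⟨ ⋆-comm a (delay b) m ⟩
    (delay b ⋆ a) m   ≡⟨ ⋆-delayˡ b a m ⟩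
    delay (b ⋆ a) m   ≡⟨ delay-cong (⋆-comm b a) m ⟩
    delay (a ⋆ b) m   ∎

  module ⋆-Inverse (s : ℕ → F) (s₀⁻¹ : F) (s₀⁻¹*s₀≡1 : s₀⁻¹ * s 0 ≡ 1#) where

    next : (ℕ → F) → ℕ → F
    next u m = - (s₀⁻¹ * sumUpTo (λ j → s (suc j) * u (m ∸ j)) m)

    -- approx m tabulates the first m + 1 coefficients of 1/s, making the recursion structural.
    approx : ℕ → ℕ → F
    approx zero    i = s₀⁻¹
    approx (suc m) i with i ℕ.≤? m
    ... | yes _ = approx m i
    ... | no  _ = next (approx m) m

    inv : ℕ → F
    inv i = approx i i

    inv-suc : ∀ m → inv (suc m) ≡ next (approx m) m
    inv-suc m with suc m ℕ.≤? m
    ... | yes 1+m≤m = ⊥-elim (ℕP.<-irrefl refl 1+m≤m)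
    ... | no  _     = refl

    approx-stable : ∀ m i → i ℕ.≤ m → approx m i ≡ inv i
    approx-stable zero    zero    z≤n = refl
    approx-stable (suc m) i i≤1+m with i ℕ.≤? m
    ... | yes i≤m = approx-stable m i i≤m
    ... | no  i≰m = trans (sym (inv-suc m)) (cong inv (ℕP.≤-antisym (ℕP.≰⇒> i≰m) i≤1+m))

    ⋆-inverseʳ : s ⋆ inv ≗ δ
    ⋆-inverseʳ zero    = trans (FR.*-comm _ _) s₀⁻¹*s₀≡1
    ⋆-inverseʳ (suc m) = begin
      (s ⋆ inv) (suc m)                                  ≡⟨ sum-suc _ m ⟩
      s 0 * inv (suc m) + sumUpTo (λ j → s (suc j) * inv (m ∸ j)) m
        ≡⟨ cong₂ _+_ (cong (s 0 *_) (inv-suc m)) (sum-cong m λ j →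
             cong (s (suc j) *_) (sym (approx-stable m (m ∸ j) (ℕP.m∸n≤m m j)))) ⟩
      s 0 * - (s₀⁻¹ * σ) + σ                  ≡⟨ cong (_+ σ) (-‿distribʳ-* _ _) ⟨
      - (s 0 * (s₀⁻¹ * σ)) + σ                ≡⟨ cong (λ z → - z + σ) (FR.*-assoc _ _ _) ⟨
      - ((s 0 * s₀⁻¹) * σ) + σ
        ≡⟨ cong (λ z → - (z * σ) + σ) (trans (FR.*-comm _ _) s₀⁻¹*s₀≡1) ⟩
      - (1# * σ) + σ                          ≡⟨ cong (λ z → - z + σ) (FR.*-identityˡ σ) ⟩
      - σ + σ                                 ≡⟨ FR.-‿inverseˡ σ ⟩
      0#                                      ∎
      where
      σ : F
      σ = sumUpTo (λ j → s (suc j) * approx m (m ∸ j)) m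

  -- Laurent series

  -- coeffsFrom N a j is the coefficient of X^(N - j); on these sequences _*K_ becomes _⋆_.
  coeffsFrom : ℤ → K → ℕ → F
  coeffsFrom N a j = coeff a (N ℤ.- + j)

  coeff-mkK : ∀ N s j → coeff (mkK N s) (N ℤ.- + j) ≡ s j
  coeff-mkK N s j with (N ℤ.- + j) ℤ.≤? N
  ... | yes _   = cong s (cong ℤ.∣_∣ (a-[a-b]≡b N (+ j)))
  ... | no  N-j≰N = ⊥-elim (N-j≰N (ℤP.i-j≤i N (+ j)))

  coeff-above-top : ∀ a {k} → top a ℤ.< k → coeff a k ≡ 0#
  coeff-above-top a {k} top<k with k ℤ.≤? top a
  ... | yes k≤top = ⊥-elim (ℤP.<⇒≱ top<k k≤top)
  ... | no  _     = refl

  coeff-0K : ∀ k → coeff 0K k ≡ 0#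
  coeff-0K k with k ℤ.≤? + 0
  ... | yes _ = refl
  ... | no  _ = refl

  ≈K-from-coeffs : ∀ {a b} N → top a ℤ.≤ N → top b ℤ.≤ N →
    coeffsFrom N a ≗ coeffsFrom N b → a ≈K b
  ≈K-from-coeffs {a} {b} N ta≤N tb≤N a≗b k with above-or-below N k
  ... | inj₁ N<k = trans (coeff-above-top a (ℤP.≤-<-trans ta≤N N<k))
                         (sym (coeff-above-top b (ℤP.≤-<-trans tb≤N N<k)))
  ... | inj₂ (j , refl) = a≗b j

  ≈K-isEquivalence : IsEquivalence _≈K_
  ≈K-isEquivalence = record
    { refl  = λ _ → refl
    ; sym   = λ a≈b k → sym (a≈b k)
    ; trans = λ a≈b b≈c k → trans (a≈b k) (b≈c k)
    }

  ≈K-setoid : Setoid 0ℓ 0ℓ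
  ≈K-setoid = record { isEquivalence = ≈K-isEquivalence }

  open IsEquivalence ≈K-isEquivalence public
    using () renaming (refl to ≈K-refl; sym to ≈K-sym; trans to ≈K-trans)

  coeff-+K : ∀ a b k → coeff (a +K b) k ≡ coeff a k + coeff b k
  coeff-+K a b k with above-or-below (top a ℤ.⊔ top b) k
  ... | inj₁ top<k = begin
    coeff (a +K b) k    ≡⟨ coeff-above-top (a +K b) top<k ⟩
    0#                  ≡⟨ FR.+-identityʳ 0# ⟨
    0# + 0#             ≡⟨ cong₂ _+_ (coeff-above-top a (ℤP.≤-<-trans (ℤP.i≤i⊔j _ _) top<k))
                                     (coeff-above-top b (ℤP.≤-<-trans (ℤP.i≤j⊔i _ _) top<k)) ⟨
    coeff a k + coeff b k ∎
  ... | inj₂ (j , refl) = coeff-mkK (top a ℤ.⊔ top b) _ j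

  coeff--K : ∀ a k → coeff (-K a) k ≡ - coeff a k
  coeff--K a k with k ℤ.≤? top a
  ... | yes _ = refl
  ... | no  _ = sym -0#≈0#

  coeff-minus : ∀ a b k → coeff (a -K b) k ≡ coeff a k + - coeff b k
  coeff-minus a b k = trans (coeff-+K a (-K b) k) (cong (λ z → coeff a k + z) (coeff--K b k))

  +K-cong : ∀ {a a' b b'} → a ≈K a' → b ≈K b' → (a +K b) ≈K (a' +K b')
  +K-cong {a} {a'} {b} {b'} a≈a' b≈b' k =
    trans (coeff-+K a b k) (trans (cong₂ _+_ (a≈a' k) (b≈b' k)) (sym (coeff-+K a' b' k)))

  -K-cong : ∀ {a a'} → a ≈K a' → (-K a) ≈K (-K a')
  -K-cong {a} {a'} a≈a' k = trans (coeff--K a k) (trans (cong -_ (a≈a' k)) (sym (coeff--K a' k)))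

  coeffsFrom-delay : ∀ a {N} → top a ℤ.≤ N → coeffsFrom (N ℤ.+ + 1) a ≗ delay (coeffsFrom N a)
  coeffsFrom-delay a {N} ta≤N zero    = coeff-above-top a
    (ℤP.≤-<-trans ta≤N (ℤP.suc[i]≤j⇒i<j (ℤP.≤-reflexive (1+a≡a+1-0 N))))
  coeffsFrom-delay a {N} ta≤N (suc j) = cong (coeff a) (a+1-[1+b]≡a-b N (+ j))

  coeffsFrom-*K : ∀ a b {N N'} → top a ℤ.≤ N → top b ℤ.≤ N' →
    coeffsFrom (N ℤ.+ N') (a *K b) ≗ coeffsFrom N a ⋆ coeffsFrom N' b
  coeffsFrom-*K a b ta≤N tb≤N' with ≤⇒≡+offset ta≤N | ≤⇒≡+offset tb≤N'
  ... | p , refl | p' , refl = padded p p'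
    where
    A B : ℕ → ℤ
    A p = top a ℤ.+ + p
    B p = top b ℤ.+ + p
    top≤A : ∀ p → top a ℤ.≤ A p
    top≤A p = ℤP.i≤i+j (top a) (+ p)
    top≤B : ∀ p → top b ℤ.≤ B p
    top≤B p = ℤP.i≤i+j (top b) (+ p)
    padded : ∀ p p' → coeffsFrom (A p ℤ.+ B p') (a *K b) ≗ coeffsFrom (A p) a ⋆ coeffsFrom (B p') b
    padded zero zero m rewrite ℤP.+-identityʳ (top a) | ℤP.+-identityʳ (top b) =
      trans (coeff-mkK (top a ℤ.+ top b) _ m)
            (⋆-cong (sym ∘ coeff-mkK (top a) (c a)) (sym ∘ coeff-mkK (top b) (c b)) m)
    padded (suc p) p' m = begin
      coeffsFrom (A (suc p) ℤ.+ B p') (a *K b) m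
        ≡⟨ cong (λ N → coeffsFrom N (a *K b) m) (a+[1+b]+c≡a+b+c+1 (top a) (+ p) (B p')) ⟩
      coeffsFrom (A p ℤ.+ B p' ℤ.+ + 1) (a *K b) m
        ≡⟨ coeffsFrom-delay (a *K b) (ℤP.+-mono-≤ (top≤A p) (top≤B p')) m ⟩
      delay (coeffsFrom (A p ℤ.+ B p') (a *K b)) m
        ≡⟨ delay-cong (padded p p') m ⟩
      delay (coeffsFrom (A p) a ⋆ coeffsFrom (B p') b) m
        ≡⟨ ⋆-delayˡ (coeffsFrom (A p) a) (coeffsFrom (B p') b) m ⟨
      (delay (coeffsFrom (A p) a) ⋆ coeffsFrom (B p') b) m
        ≡⟨ ⋆-cong {b = coeffsFrom (B p') b} (λ j → trans (sym (coeffsFrom-delay a (top≤A p) j))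
                                (cong (λ N → coeffsFrom N a j) (sym (a+[1+b]≡a+b+1 (top a) (+ p)))))
                  (λ _ → refl) m ⟩
      (coeffsFrom (A (suc p)) a ⋆ coeffsFrom (B p') b) m ∎
    padded zero (suc p') m = begin
      coeffsFrom (A 0 ℤ.+ B (suc p')) (a *K b) m
        ≡⟨ cong (λ N → coeffsFrom N (a *K b) m) (a+[b+[1+c]]≡a+[b+c]+1 (A 0) (top b) (+ p')) ⟩
      coeffsFrom (A 0 ℤ.+ B p' ℤ.+ + 1) (a *K b) m
        ≡⟨ coeffsFrom-delay (a *K b) (ℤP.+-mono-≤ (top≤A 0) (top≤B p')) m ⟩
      delay (coeffsFrom (A 0 ℤ.+ B p') (a *K b)) m
        ≡⟨ delay-cong (padded 0 p') m ⟩
      delay (coeffsFrom (A 0) a ⋆ coeffsFrom (B p') b) m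
        ≡⟨ ⋆-delayʳ (coeffsFrom (A 0) a) (coeffsFrom (B p') b) m ⟨
      (coeffsFrom (A 0) a ⋆ delay (coeffsFrom (B p') b)) m
        ≡⟨ ⋆-cong {a = coeffsFrom (A 0) a} (λ _ → refl)
                  (λ j → trans (sym (coeffsFrom-delay b (top≤B p') j))
                                (cong (λ N → coeffsFrom N b j) (sym (a+[1+b]≡a+b+1 (top b) (+ p'))))) m ⟩
      (coeffsFrom (A 0) a ⋆ coeffsFrom (B (suc p')) b) m ∎

  *K-cong : ∀ {a a' b b'} → a ≈K a' → b ≈K b' → (a *K b) ≈K (a' *K b')
  *K-cong {a} {a'} {b} {b'} a≈a' b≈b' =
    ≈K-from-coeffs (Na ℤ.+ Nb) (ℤP.+-mono-≤ a≤ b≤) (ℤP.+-mono-≤ a'≤ b'≤) λ m → begin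
      coeffsFrom (Na ℤ.+ Nb) (a *K b) m        ≡⟨ coeffsFrom-*K a b a≤ b≤ m ⟩
      (coeffsFrom Na a ⋆ coeffsFrom Nb b) m
        ≡⟨ ⋆-cong (λ j → a≈a' (Na ℤ.- + j)) (λ j → b≈b' (Nb ℤ.- + j)) m ⟩
      (coeffsFrom Na a' ⋆ coeffsFrom Nb b') m  ≡⟨ coeffsFrom-*K a' b' a'≤ b'≤ m ⟨
      coeffsFrom (Na ℤ.+ Nb) (a' *K b') m      ∎
    where
    Na Nb : ℤ
    Na = top a ℤ.⊔ top a'
    Nb = top b ℤ.⊔ top b'
    a≤ : top a ℤ.≤ Na
    a≤ = ℤP.i≤i⊔j (top a) (top a')
    a'≤ : top a' ℤ.≤ Na
    a'≤ = ℤP.i≤j⊔i (top a) (top a')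
    b≤ : top b ℤ.≤ Nb
    b≤ = ℤP.i≤i⊔j (top b) (top b')
    b'≤ : top b' ℤ.≤ Nb
    b'≤ = ℤP.i≤j⊔i (top b) (top b')

  *K-comm : ∀ a b → (a *K b) ≈K (b *K a)
  *K-comm a b =
    ≈K-from-coeffs (top a ℤ.+ top b) ℤP.≤-refl (ℤP.≤-reflexive (ℤP.+-comm (top b) (top a))) λ m → begin
    coeffsFrom (top a ℤ.+ top b) (a *K b) m            ≡⟨ coeffsFrom-*K a b ℤP.≤-refl ℤP.≤-refl m ⟩
    (coeffsFrom (top a) a ⋆ coeffsFrom (top b) b) m    ≡⟨ ⋆-comm (coeffsFrom (top a) a) _ m ⟩
    (coeffsFrom (top b) b ⋆ coeffsFrom (top a) a) m    ≡⟨ coeffsFrom-*K b a ℤP.≤-refl ℤP.≤-refl m ⟨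
    coeffsFrom (top b ℤ.+ top a) (b *K a) m
      ≡⟨ cong (λ N → coeffsFrom N (b *K a) m) (ℤP.+-comm (top b) (top a)) ⟩
    coeffsFrom (top a ℤ.+ top b) (b *K a) m            ∎

  *K-assoc : ∀ a b c → ((a *K b) *K c) ≈K (a *K (b *K c))
  *K-assoc a b c = ≈K-from-coeffs (top a ℤ.+ top b ℤ.+ top c) ℤP.≤-refl
    (ℤP.≤-reflexive (sym (ℤP.+-assoc (top a) (top b) (top c)))) λ m → begin
      coeffsFrom (top a ℤ.+ top b ℤ.+ top c) ((a *K b) *K c) m
        ≡⟨ coeffsFrom-*K (a *K b) c ℤP.≤-refl ℤP.≤-refl m ⟩
      (coeffsFrom (top a ℤ.+ top b) (a *K b) ⋆ C) m
        ≡⟨ ⋆-cong {b = C} (coeffsFrom-*K a b ℤP.≤-refl ℤP.≤-refl) (λ _ → refl) m ⟩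
      ((A ⋆ B) ⋆ C) m
        ≡⟨ ⋆-assoc A B C m ⟩
      (A ⋆ (B ⋆ C)) m
        ≡⟨ ⋆-cong {a = A} (λ _ → refl) (coeffsFrom-*K b c ℤP.≤-refl ℤP.≤-refl) m ⟨
      (A ⋆ coeffsFrom (top b ℤ.+ top c) (b *K c)) m
        ≡⟨ coeffsFrom-*K a (b *K c) ℤP.≤-refl ℤP.≤-refl m ⟨
      coeffsFrom (top a ℤ.+ (top b ℤ.+ top c)) (a *K (b *K c)) m
        ≡⟨ cong (λ N → coeffsFrom N (a *K (b *K c)) m) (ℤP.+-assoc (top a) (top b) (top c)) ⟨
      coeffsFrom (top a ℤ.+ top b ℤ.+ top c) (a *K (b *K c)) m ∎
    where
    A B C : ℕ → F
    A = coeffsFrom (top a) a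
    B = coeffsFrom (top b) b
    C = coeffsFrom (top c) c

  *K-distribˡ-+K : ∀ a b c → (a *K (b +K c)) ≈K ((a *K b) +K (a *K c))
  *K-distribˡ-+K a b c = ≈K-from-coeffs (top a ℤ.+ N) ℤP.≤-refl
    (ℤP.⊔-lub (ℤP.+-monoʳ-≤ (top a) (ℤP.i≤i⊔j _ _)) (ℤP.+-monoʳ-≤ (top a) (ℤP.i≤j⊔i _ _)))
    λ m → begin
      coeffsFrom (top a ℤ.+ N) (a *K (b +K c)) m
        ≡⟨ coeffsFrom-*K a (b +K c) ℤP.≤-refl ℤP.≤-refl m ⟩
      (A ⋆ coeffsFrom N (b +K c)) m
        ≡⟨ ⋆-cong {a = A} (λ _ → refl) (λ j → coeff-+K b c (N ℤ.- + j)) m ⟩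
      (A ⋆ (λ j → coeffsFrom N b j + coeffsFrom N c j)) m
        ≡⟨ ⋆-distribˡ-+ A (coeffsFrom N b) (coeffsFrom N c) m ⟩
      (A ⋆ coeffsFrom N b) m + (A ⋆ coeffsFrom N c) m
        ≡⟨ cong₂ _+_ (coeffsFrom-*K a b ℤP.≤-refl (ℤP.i≤i⊔j _ _) m)
                     (coeffsFrom-*K a c ℤP.≤-refl (ℤP.i≤j⊔i _ _) m) ⟨
      coeffsFrom (top a ℤ.+ N) (a *K b) m + coeffsFrom (top a ℤ.+ N) (a *K c) m
        ≡⟨ coeff-+K (a *K b) (a *K c) (top a ℤ.+ N ℤ.- + m) ⟨
      coeffsFrom (top a ℤ.+ N) ((a *K b) +K (a *K c)) m ∎
    where
    N : ℤ
    N = top b ℤ.⊔ top c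
    A : ℕ → F
    A = coeffsFrom (top a) a

  *K-negˡ : ∀ a b → ((-K a) *K b) ≈K (-K (a *K b))
  *K-negˡ a b = ≈K-from-coeffs (top a ℤ.+ top b) ℤP.≤-refl ℤP.≤-refl λ m → begin
    coeffsFrom (top a ℤ.+ top b) ((-K a) *K b) m      ≡⟨ coeffsFrom-*K (-K a) b ℤP.≤-refl ℤP.≤-refl m ⟩
    (coeffsFrom (top a) (-K a) ⋆ B) m
      ≡⟨ ⋆-cong {b = B} (λ j → coeff--K a (top a ℤ.- + j)) (λ _ → refl) m ⟩
    ((λ j → - coeffsFrom (top a) a j) ⋆ B) m          ≡⟨ ⋆-negˡ (coeffsFrom (top a) a) B m ⟩
    - (coeffsFrom (top a) a ⋆ B) m
      ≡⟨ cong -_ (coeffsFrom-*K a b ℤP.≤-refl ℤP.≤-refl m) ⟨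
    - coeffsFrom (top a ℤ.+ top b) (a *K b) m          ≡⟨ coeff--K (a *K b) (top a ℤ.+ top b ℤ.- + m) ⟨
    coeffsFrom (top a ℤ.+ top b) (-K (a *K b)) m       ∎
    where
    B : ℕ → F
    B = coeffsFrom (top b) b

  coeffsFrom-Xpow : ∀ m → coeffsFrom m (Xpow m) ≗ δ
  coeffsFrom-Xpow m zero    = coeff-mkK m _ 0
  coeffsFrom-Xpow m (suc j) = coeff-mkK m _ (suc j)

  1K : K
  1K = Xpow (+ 0)

  coeff-Xpow-*K : ∀ m b k → coeff (Xpow m *K b) k ≡ coeff b (k ℤ.- m)
  coeff-Xpow-*K m b k with above-or-below (top b) (k ℤ.- m)
  ... | inj₁ top<k-m = trans (coeff-above-top (Xpow m *K b) top<m+k)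
                             (sym (coeff-above-top b top<k-m))
    where
    top<m+k : m ℤ.+ top b ℤ.< k
    top<m+k = subst (m ℤ.+ top b ℤ.<_) (a+[b-a]≡b m k) (ℤP.+-monoʳ-< m top<k-m)
  ... | inj₂ (j , k-m≡) = begin
    coeff (Xpow m *K b) k                  ≡⟨ cong (coeff (Xpow m *K b)) k≡ ⟩
    coeffsFrom (m ℤ.+ top b) (Xpow m *K b) j ≡⟨ coeffsFrom-*K (Xpow m) b ℤP.≤-refl ℤP.≤-refl j ⟩
    (coeffsFrom m (Xpow m) ⋆ coeffsFrom (top b) b) j
      ≡⟨ ⋆-cong {b = coeffsFrom (top b) b} (coeffsFrom-Xpow m) (λ _ → refl) j ⟩
    (δ ⋆ coeffsFrom (top b) b) j          ≡⟨ ⋆-identityˡ (coeffsFrom (top b) b) j ⟩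
    coeffsFrom (top b) b j                ≡⟨ cong (coeff b) k-m≡ ⟨
    coeff b (k ℤ.- m)                     ∎
    where
    k≡ : k ≡ m ℤ.+ top b ℤ.- + j
    k≡ = trans (sym (a+[b-a]≡b m k)) (trans (cong (λ z → m ℤ.+ z) k-m≡) (a+[b-c]≡a+b-c m (top b) (+ j)))

  *K-identityˡ : ∀ b → (1K *K b) ≈K b
  *K-identityˡ b k = trans (coeff-Xpow-*K (+ 0) b k) (cong (coeff b) (ℤP.+-identityʳ k))

  Xpow-*K-≉0K : ∀ {a} m → ¬ (a ≈K 0K) → ¬ ((Xpow m *K a) ≈K 0K)
  Xpow-*K-≉0K {a} m a≉0 Xa≈0 = a≉0 λ k → begin
    coeff a k                        ≡⟨ cong (coeff a) ([a+b]-b≡a k m) ⟨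
    coeff a (k ℤ.+ m ℤ.- m)          ≡⟨ coeff-Xpow-*K m a (k ℤ.+ m) ⟨
    coeff (Xpow m *K a) (k ℤ.+ m)    ≡⟨ Xa≈0 (k ℤ.+ m) ⟩
    coeff 0K (k ℤ.+ m)               ≡⟨ coeff-0K (k ℤ.+ m) ⟩
    0#                               ≡⟨ coeff-0K k ⟨
    coeff 0K k                       ∎

  *K-zeroˡ : ∀ b → (0K *K b) ≈K 0K
  *K-zeroˡ b =
    ≈K-from-coeffs (+ 0 ℤ.+ N) (ℤP.+-monoʳ-≤ (+ 0) b≤N) (ℤP.+-monoʳ-≤ (+ 0) 0≤N) λ m → begin
    coeffsFrom (+ 0 ℤ.+ N) (0K *K b) m            ≡⟨ coeffsFrom-*K 0K b ℤP.≤-refl b≤N m ⟩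
    (coeffsFrom (+ 0) 0K ⋆ coeffsFrom N b) m
      ≡⟨ ⋆-cong {b = coeffsFrom N b} (coeff-mkK (+ 0) _) (λ _ → refl) m ⟩
    ((λ _ → 0#) ⋆ coeffsFrom N b) m                ≡⟨ ⋆-zeroˡ (coeffsFrom N b) m ⟩
    0#                                             ≡⟨ coeff-0K (+ 0 ℤ.+ N ℤ.- + m) ⟨
    coeffsFrom (+ 0 ℤ.+ N) 0K m                    ∎
    where
    N : ℤ
    N = top b ℤ.⊔ + 0
    b≤N : top b ℤ.≤ N
    b≤N = ℤP.i≤i⊔j (top b) (+ 0)
    0≤N : + 0 ℤ.≤ N
    0≤N = ℤP.i≤j⊔i (top b) (+ 0)

  *K-distribʳ-+K : ∀ a b c → ((b +K c) *K a) ≈K ((b *K a) +K (c *K a))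
  *K-distribʳ-+K a b c = ≈K-trans (*K-comm (b +K c) a)
    (≈K-trans (*K-distribˡ-+K a b c) (+K-cong (*K-comm a b) (*K-comm a c)))

  *K-negʳ : ∀ a b → (a *K (-K b)) ≈K (-K (a *K b))
  *K-negʳ a b = ≈K-trans (*K-comm a (-K b)) (≈K-trans (*K-negˡ b a) (-K-cong (*K-comm b a)))

  *K-distribˡ--K : ∀ a b c → (a *K (b -K c)) ≈K ((a *K b) -K (a *K c))
  *K-distribˡ--K a b c = ≈K-trans (*K-distribˡ-+K a b (-K c)) (+K-cong ≈K-refl (*K-negʳ a c))

  *K-distribʳ--K : ∀ a b c → ((b -K c) *K a) ≈K ((b *K a) -K (c *K a))
  *K-distribʳ--K a b c = ≈K-trans (*K-distribʳ-+K a b (-K c)) (+K-cong ≈K-refl (*K-negˡ c a))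

  -K-anti-homo-minus : ∀ a b → (-K (a -K b)) ≈K (b -K a)
  -K-anti-homo-minus a b k = begin
    coeff (-K (a -K b)) k            ≡⟨ coeff--K (a -K b) k ⟩
    - coeff (a -K b) k               ≡⟨ cong -_ (coeff-minus a b k) ⟩
    - (coeff a k + - coeff b k)      ≡⟨ ⁻¹-anti-homo‿- (coeff a k) (coeff b k) ⟩
    coeff b k + - coeff a k          ≡⟨ coeff-minus b a k ⟨
    coeff (b -K a) k                 ∎

  DegreeAtMost : K → ℤ → Set
  DegreeAtMost a A = ∀ k → A ℤ.< k → coeff a k ≡ 0#

  DegreeAtMost-≈K : ∀ {a b A} → a ≈K b → DegreeAtMost a A → DegreeAtMost b A
  DegreeAtMost-≈K a≈b a≤A k A<k = trans (sym (a≈b k)) (a≤A k A<k)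

  DegreeAtMost-mono : ∀ {a A A'} → A ℤ.≤ A' → DegreeAtMost a A → DegreeAtMost a A'
  DegreeAtMost-mono A≤A' a≤A k A'<k = a≤A k (ℤP.≤-<-trans A≤A' A'<k)

  withTop : ℤ → K → K
  withTop A a = mkK A (coeffsFrom A a)

  withTop-≈K : ∀ {a A} → DegreeAtMost a A → a ≈K withTop A a
  withTop-≈K {a} {A} a≤A k with above-or-below A k
  ... | inj₁ A<k = trans (a≤A k A<k) (sym (coeff-above-top (withTop A a) A<k))
  ... | inj₂ (j , refl) = sym (coeff-mkK A _ j)

  DegreeAtMost-*K : ∀ {a b A B} → DegreeAtMost a A → DegreeAtMost b B → DegreeAtMost (a *K b) (A ℤ.+ B)
  DegreeAtMost-*K {a} {b} {A} {B} a≤A b≤B k A+B<k =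
    trans (*K-cong (withTop-≈K a≤A) (withTop-≈K b≤B) k) (coeff-above-top (withTop A a *K withTop B b) A+B<k)

  *K-inverse : ∀ {a D} → DegreeAtMost a D → coeff a D ≢ 0# →
    ∃ λ u → DegreeAtMost u (ℤ.- D) × (a *K u) ≈K 1K
  *K-inverse {a} {D} a≤D aD≢0 = u , (λ _ → coeff-above-top u) , a*u≈1
    where
    s : ℕ → F
    s = coeffsFrom D a
    s₀≢0 : s 0 ≢ 0#
    s₀≢0 = aD≢0 ∘ trans (cong (coeff a) (sym (ℤP.+-identityʳ D)))
    s₀⁻¹ : F
    s₀⁻¹ = proj₁ (inverse (s 0) s₀≢0)
    open ⋆-Inverse s s₀⁻¹ (proj₂ (inverse (s 0) s₀≢0)) using (inv; ⋆-inverseʳ)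
    u : K
    u = mkK (ℤ.- D) inv
    a*u≈1 : (a *K u) ≈K 1K
    a*u≈1 = ≈K-trans (*K-cong (withTop-≈K a≤D) (≈K-refl {u}))
      (≈K-from-coeffs (D ℤ.+ ℤ.- D) ℤP.≤-refl (ℤP.≤-reflexive (sym (ℤP.+-inverseʳ D))) λ m → begin
        coeffsFrom (D ℤ.+ ℤ.- D) (withTop D a *K u) m
          ≡⟨ coeffsFrom-*K (withTop D a) u ℤP.≤-refl ℤP.≤-refl m ⟩
        (coeffsFrom D (withTop D a) ⋆ coeffsFrom (ℤ.- D) u) m
          ≡⟨ ⋆-cong {a' = s} {b' = inv} (coeff-mkK D s) (coeff-mkK (ℤ.- D) inv) m ⟩
        (s ⋆ inv) m                                     ≡⟨ ⋆-inverseʳ m ⟩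
        δ m                                             ≡⟨ coeffsFrom-Xpow (+ 0) m ⟨
        coeffsFrom (+ 0) 1K m                           ≡⟨ cong (λ N → coeffsFrom N 1K m) (ℤP.+-inverseʳ D) ⟨
        coeffsFrom (D ℤ.+ ℤ.- D) 1K m                   ∎)

  DegreeAtMost-Xpow : ∀ m → DegreeAtMost (Xpow m) m
  DegreeAtMost-Xpow m _ = coeff-above-top (Xpow m)

  DegreeAtMost--K : ∀ {a A} → DegreeAtMost a A → DegreeAtMost (-K a) A
  DegreeAtMost--K {a} a≤A k A<k = trans (coeff--K a k) (trans (cong -_ (a≤A k A<k)) -0#≈0#)

  *K-cancelˡ : ∀ {a u} y → (a *K u) ≈K 1K → (u *K (a *K y)) ≈K y
  *K-cancelˡ {a} {u} y a*u≈1 = ≈K-trans (≈K-sym (*K-assoc u a y))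
    (≈K-trans (*K-cong (≈K-trans (*K-comm u a) a*u≈1) (≈K-refl {y})) (*K-identityˡ y))

  DegreeAtMost-cancelˡ : ∀ {a y D A} → DegreeAtMost a D → coeff a D ≢ 0# →
    DegreeAtMost (a *K y) A → DegreeAtMost y (ℤ.- D ℤ.+ A)
  DegreeAtMost-cancelˡ {a} {y} a≤D aD≢0 ay≤A with *K-inverse a≤D aD≢0
  ... | u , u≤-D , a*u≈1 = DegreeAtMost-≈K (*K-cancelˡ {a} {u} y a*u≈1) (DegreeAtMost-*K u≤-D ay≤A)

  leading-coeff : ∀ {a A k} → DegreeAtMost a A → coeff a k ≢ 0# →
    ∃ λ D → k ℤ.≤ D × coeff a D ≢ 0# × DegreeAtMost a D
  leading-coeff {a} {A} {k} a≤A aₖ≢0 with k ℤ.≤? A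
  ... | no  k≰A = ⊥-elim (aₖ≢0 (a≤A k (ℤP.≰⇒> k≰A)))
  ... | yes k≤A with ≤⇒≡+offset k≤A
  ...   | L , refl = search L a≤A
    where
    search : ∀ L → DegreeAtMost a (k ℤ.+ + L) → ∃ λ D → k ℤ.≤ D × coeff a D ≢ 0# × DegreeAtMost a D
    search zero    a≤k     = k , ℤP.≤-refl , aₖ≢0 , subst (DegreeAtMost a) (ℤP.+-identityʳ k) a≤k
    search (suc L) a≤k+1+L with coeff a (k ℤ.+ + suc L) ≟F 0#
    ... | no  a-top≢0 = k ℤ.+ + suc L , ℤP.i≤i+j k (+ suc L) , a-top≢0 , a≤k+1+L
    ... | yes a-top≡0 = search L λ j k+L<j → case j ℤ.≟ k ℤ.+ + suc L of λ where
      (yes refl) → a-top≡0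
      (no  j≢)   → a≤k+1+L j (subst (ℤ._< j) (sym (a+[1+b]≡1+[a+b] k (+ L)))
                     (ℤP.≤∧≢⇒< (ℤP.i<j⇒suc[i]≤j k+L<j)
                               λ e → j≢ (sym (trans (a+[1+b]≡1+[a+b] k (+ L)) e))))

  DegreeAtMost⇒AbsLe : ∀ {a A} → DegreeAtMost a A → AbsLe a A (+ 1)
  DegreeAtMost⇒AbsLe {A = A} a≤A k A<1*k = a≤A k (subst (A ℤ.<_) (ℤP.*-identityˡ k) A<1*k)

  AbsLe⇒DegreeAtMost : ∀ {a A} → AbsLe a A (+ 1) → DegreeAtMost a A
  AbsLe⇒DegreeAtMost {A = A} a≤A k A<k = a≤A k (subst (A ℤ.<_) (sym (ℤP.*-identityˡ k)) A<k)

  DegreeAtMost⇒AbsLeHalfExp : ∀ {a A m} → DegreeAtMost a A → A ℤ.< m → AbsLeHalfExp a m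
  DegreeAtMost⇒AbsLeHalfExp a≤A A<m k m≤k = a≤A k (ℤP.<-≤-trans A<m m≤k)

  AbsGe⇒≤*degree : ∀ {a A num den} → DegreeAtMost a A → AbsGe a num (+ den) → num ℤ.≤ + den ℤ.* A
  AbsGe⇒≤*degree {A = A} {den = den} a≤A (k , aₖ≢0 , num≤den*k) with k ℤ.≤? A
  ... | yes k≤A = ℤP.≤-trans num≤den*k (ℤP.*-monoˡ-≤-nonNeg (+ den) k≤A)
  ... | no  k≰A = ⊥-elim (aₖ≢0 (a≤A k (ℤP.≰⇒> k≰A)))

  AbsGe-weaken : ∀ {a num num' den} → num' ℤ.≤ num → AbsGe a num den → AbsGe a num' den
  AbsGe-weaken num'≤num (k , aₖ≢0 , num≤den*k) = k , aₖ≢0 , ℤP.≤-trans num'≤num num≤den*k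

  AbsGe-Xpow-*K : ∀ {a m num den} → AbsGe (Xpow m *K a) num den → AbsGe a (num ℤ.- den ℤ.* m) den
  AbsGe-Xpow-*K {a} {m} {num} {den} (k , aₖ≢0 , num≤den*k) =
    k ℤ.- m , (λ e → aₖ≢0 (trans (coeff-Xpow-*K m a k) e)) ,
    subst (num ℤ.- den ℤ.* m ℤ.≤_) (a*b-a*c≡a*[b-c] den k m) (ℤP.+-monoˡ-≤ (ℤ.- (den ℤ.* m)) num≤den*k)

  -- Polynomials

  polyCoeff : Poly → ℕ → F
  polyCoeff []      _       = 0#
  polyCoeff (a ∷ p) zero    = a
  polyCoeff (a ∷ p) (suc j) = polyCoeff p j

  coeff-toK-nonneg : ∀ p j → coeff (toK p) (+ j) ≡ polyCoeff p j
  coeff-toK-neg : ∀ p j → coeff (toK p) -[1+ j ] ≡ 0#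
  coeff-toK-nonneg []      j       = coeff-0K (+ j)
  coeff-toK-nonneg (a ∷ p) zero    = begin
    coeff (constK a +K (Xpow (+ 1) *K toK p)) (+ 0)
      ≡⟨ coeff-+K (constK a) (Xpow (+ 1) *K toK p) (+ 0) ⟩
    coeff (constK a) (+ 0) + coeff (Xpow (+ 1) *K toK p) (+ 0)
      ≡⟨ cong₂ _+_ (coeff-mkK (+ 0) (c (constK a)) 0)
                   (trans (coeff-Xpow-*K (+ 1) (toK p) (+ 0)) (coeff-toK-neg p 0)) ⟩
    a + 0#
      ≡⟨ FR.+-identityʳ a ⟩
    a ∎
  coeff-toK-nonneg (a ∷ p) (suc j) = begin
    coeff (constK a +K (Xpow (+ 1) *K toK p)) (+ suc j)
      ≡⟨ coeff-+K (constK a) (Xpow (+ 1) *K toK p) (+ suc j) ⟩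
    coeff (constK a) (+ suc j) + coeff (Xpow (+ 1) *K toK p) (+ suc j)
      ≡⟨ cong₂ _+_ (coeff-above-top (constK a) (ℤ.+<+ {0} {suc j} (s≤s z≤n)))
                   (trans (coeff-Xpow-*K (+ 1) (toK p) (+ suc j)) (coeff-toK-nonneg p j)) ⟩
    0# + polyCoeff p j
      ≡⟨ FR.+-identityˡ _ ⟩
    polyCoeff p j ∎
  coeff-toK-neg []      j = coeff-0K -[1+ j ]
  coeff-toK-neg (a ∷ p) j = begin
    coeff (constK a +K (Xpow (+ 1) *K toK p)) -[1+ j ]
      ≡⟨ coeff-+K (constK a) (Xpow (+ 1) *K toK p) -[1+ j ] ⟩
    coeff (constK a) -[1+ j ] + coeff (Xpow (+ 1) *K toK p) -[1+ j ]
      ≡⟨ cong₂ _+_ (coeff-below a) (begin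
        coeff (Xpow (+ 1) *K toK p) -[1+ j ]   ≡⟨ coeff-Xpow-*K (+ 1) (toK p) -[1+ j ] ⟩
        coeff (toK p) -[1+ suc (j ℕ.+ 0) ]     ≡⟨ cong (λ m → coeff (toK p) -[1+ suc m ]) (ℕP.+-identityʳ j) ⟩
        coeff (toK p) -[1+ suc j ]             ≡⟨ coeff-toK-neg p (suc j) ⟩
        0#                                     ∎) ⟩
    0# + 0#
      ≡⟨ FR.+-identityʳ 0# ⟩
    0# ∎
    where
    coeff-below : ∀ a → coeff (constK a) -[1+ j ] ≡ 0#
    coeff-below a with -[1+ j ] ℤ.≤? + 0
    ... | yes _  = refl
    ... | no  ¬≤ = ⊥-elim (¬≤ ℤ.-≤+)

  polyCoeff-tabulate : ∀ {d} (w : Fin d → F) l → polyCoeff (tabulate w) (Fin.toℕ l) ≡ w l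
  polyCoeff-tabulate w Fin.zero    = refl
  polyCoeff-tabulate w (Fin.suc l) = polyCoeff-tabulate (w ∘ Fin.suc) l

  polyCoeff-tabulate-≥ : ∀ {d} (w : Fin d → F) j → d ℕ.≤ j → polyCoeff (tabulate w) j ≡ 0#
  polyCoeff-tabulate-≥ {zero}  w j       _         = refl
  polyCoeff-tabulate-≥ {suc d} w (suc j) (s≤s d≤j) = polyCoeff-tabulate-≥ (w ∘ Fin.suc) j d≤j

  DegreeAtMost-ℕ : ∀ {a D} → (∀ j → D ℕ.< j → coeff a (+ j) ≡ 0#) → DegreeAtMost a (+ D)
  DegreeAtMost-ℕ a≤D (+ j) (ℤ.+<+ D<j) = a≤D j D<j

  DegreeAtMost-tabulate : ∀ {d} (w : Fin (suc d) → F) → DegreeAtMost (toK (tabulate w)) (+ d)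
  DegreeAtMost-tabulate w = DegreeAtMost-ℕ λ j d<j →
    trans (coeff-toK-nonneg (tabulate w) j) (polyCoeff-tabulate-≥ w j d<j)

  toK-tabulate-≈0K : ∀ {d} (w : Fin d → F) → (∀ l → w l ≡ 0#) → toK (tabulate w) ≈K 0K
  toK-tabulate-≈0K w w≡0 (+ j) =
    trans (coeff-toK-nonneg (tabulate w) j) (trans (all-zero w w≡0 j) (sym (coeff-0K (+ j))))
    where
    all-zero : ∀ {d} (w : Fin d → F) → (∀ l → w l ≡ 0#) → ∀ j → polyCoeff (tabulate w) j ≡ 0#
    all-zero {zero}  w w≡0 j       = refl
    all-zero {suc d} w w≡0 zero    = w≡0 Fin.zero
    all-zero {suc d} w w≡0 (suc j) = all-zero (w ∘ Fin.suc) (w≡0 ∘ Fin.suc) j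
  toK-tabulate-≈0K w w≡0 -[1+ j ] = trans (coeff-toK-neg (tabulate w) j) (sym (coeff-0K -[1+ j ]))

  DegreeAtMost-toK : ∀ p → DegreeAtMost (toK p) (+ length p)
  DegreeAtMost-toK p = DegreeAtMost-ℕ λ j len<j → trans (coeff-toK-nonneg p j) (vanish p j (ℕP.<⇒≤ len<j))
    where
    vanish : ∀ p j → length p ℕ.≤ j → polyCoeff p j ≡ 0#
    vanish []      j       _         = refl
    vanish (a ∷ p) (suc j) (s≤s l≤j) = vanish p j l≤j

  toK-tabulate-≉0K : ∀ {d} (w : Fin d → F) → ¬ (∀ l → w l ≡ 0#) → ¬ (toK (tabulate w) ≈K 0K)
  toK-tabulate-≉0K w w≢0 tab≈0 = w≢0 λ l → begin
    w l                                         ≡⟨ polyCoeff-tabulate w l ⟨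
    polyCoeff (tabulate w) (Fin.toℕ l)          ≡⟨ coeff-toK-nonneg (tabulate w) (Fin.toℕ l) ⟨
    coeff (toK (tabulate w)) (+ Fin.toℕ l)      ≡⟨ tab≈0 (+ Fin.toℕ l) ⟩
    coeff 0K (+ Fin.toℕ l)                      ≡⟨ coeff-0K (+ Fin.toℕ l) ⟩
    0#                                          ∎

  truncate : ℕ → K → Poly
  truncate d a = tabulate {n = d} (λ l → coeff a (+ Fin.toℕ l))

  coeff-truncate : ∀ {a A} d → DegreeAtMost a A → A ℤ.< + d →
    ∀ j → coeff (toK (truncate d a)) (+ j) ≡ coeff a (+ j)
  coeff-truncate {a} d a≤A A<d j with j ℕ.<? d
  ... | yes j<d = begin
    coeff (toK (truncate d a)) (+ j)                     ≡⟨ coeff-toK-nonneg (truncate d a) j ⟩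
    polyCoeff (truncate d a) j                            ≡⟨ cong (polyCoeff (truncate d a)) (FinP.toℕ-fromℕ< j<d) ⟨
    polyCoeff (truncate d a) (Fin.toℕ (Fin.fromℕ< j<d))   ≡⟨ polyCoeff-tabulate _ (Fin.fromℕ< j<d) ⟩
    coeff a (+ Fin.toℕ (Fin.fromℕ< j<d))                  ≡⟨ cong (λ i → coeff a (+ i)) (FinP.toℕ-fromℕ< j<d) ⟩
    coeff a (+ j)                                         ∎
  ... | no  j≮d = begin
    coeff (toK (truncate d a)) (+ j)   ≡⟨ coeff-toK-nonneg (truncate d a) j ⟩
    polyCoeff (truncate d a) j          ≡⟨ polyCoeff-tabulate-≥ _ j (ℕP.≮⇒≥ j≮d) ⟩
    0#                                  ≡⟨ a≤A (+ j) (ℤP.<-≤-trans A<d (ℤ.+≤+ (ℕP.≮⇒≥ j≮d))) ⟨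
    coeff a (+ j)                       ∎

  truncate-≈K : ∀ {p A} d → DegreeAtMost (toK p) A → A ℤ.< + d → toK (truncate d (toK p)) ≈K toK p
  truncate-≈K {p} d p≤A A<d (+ j)     = coeff-truncate d p≤A A<d j
  truncate-≈K {p} d p≤A A<d -[1+ j ] =
    trans (coeff-toK-neg (truncate d (toK p)) j) (sym (coeff-toK-neg p j))

  -- Siegel's lemma over 𝔽_q

  private
    module Enum = Inverse enum

  encode : ∀ {d} → (Fin d → F) → Fin (q ℕ.^ d)
  encode w = Fin.funToFin (Enum.to ∘ w)

  decode : ∀ {d} → Fin (q ℕ.^ d) → Fin d → F
  decode {d} k = Enum.from ∘ Fin.finToFun {q} {d} k

  decode-encode : ∀ {d} (w : Fin d → F) → decode (encode w) ≗ w
  decode-encode w l = trans (cong Enum.from (FinP.finToFun-funToFin (Enum.to ∘ w) l)) (Enum.strictlyInverseʳ (w l))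

  decode-injective : ∀ {d} {k k' : Fin (q ℕ.^ d)} → decode k ≗ decode k' → k ≡ k'
  decode-injective {d} {k} {k'} k≗k' = begin
    k                                    ≡⟨ FinP.funToFin-finToFin {d} {q} k ⟨
    Fin.funToFin (Fin.finToFun {q} {d} k)  ≡⟨ funToFin-cong {d} {q} (λ l → trans (sym (Enum.strictlyInverseˡ _))
                                               (trans (cong Enum.to (k≗k' l)) (Enum.strictlyInverseˡ _))) ⟩
    Fin.funToFin (Fin.finToFun {q} {d} k') ≡⟨ FinP.funToFin-finToFin {d} {q} k' ⟩
    k'                                   ∎
    where
    funToFin-cong : ∀ {m r} {f g : Fin m → Fin r} → f ≗ g → Fin.funToFin f ≡ Fin.funToFin g
    funToFin-cong {zero}  f≗g = refl
    funToFin-cong {suc m} f≗g = cong₂ Fin.combine (f≗g Fin.zero) (funToFin-cong (f≗g ∘ Fin.suc))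

  1<q : 1 ℕ.< q
  1<q = two-elements (Enum.to 0#) (Enum.to 1#) λ e →
    0≢1 (trans (sym (Enum.strictlyInverseʳ 0#)) (trans (cong Enum.from e) (Enum.strictlyInverseʳ 1#)))
    where
    two-elements : ∀ {r} (i j : Fin r) → i ≢ j → 1 ℕ.< r
    two-elements {suc zero}    Fin.zero Fin.zero i≢j = ⊥-elim (i≢j refl)
    two-elements {suc (suc r)} _        _        _   = s≤s (s≤s z≤n)

  kernel-nontrivial : ∀ {d m} → m ℕ.< d → (L : (Fin d → F) → Fin m → F) →
    (∀ w w' k → L (λ l → w l + - w' l) k ≡ L w k + - L w' k) →
    ∃ λ w → ¬ (∀ l → w l ≡ 0#) × ∀ k → L w k ≡ 0#
  kernel-nontrivial {d} m<d L L-minus with FinP.pigeonhole (ℕP.^-monoʳ-< q 1<q m<d) (encode ∘ L ∘ decode)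
  ... | k₁ , k₂ , k₁<k₂ , Lk₁≡Lk₂ = (λ l → w₁ l + - w₂ l) , w₁≢w₂ , Lw≡0
    where
    w₁ w₂ : Fin d → F
    w₁ = decode k₁
    w₂ = decode k₂
    w₁≢w₂ : ¬ (∀ l → w₁ l + - w₂ l ≡ 0#)
    w₁≢w₂ w≡0 = FinP.<⇒≢ k₁<k₂ (decode-injective {d} λ l → x∙y⁻¹≈ε⇒x≈y _ _ (w≡0 l))
    Lw≡0 : ∀ k → L (λ l → w₁ l + - w₂ l) k ≡ 0#
    Lw≡0 k = begin
      L (λ l → w₁ l + - w₂ l) k  ≡⟨ L-minus w₁ w₂ k ⟩
      L w₁ k + - L w₂ k          ≡⟨ cong (λ z → z + - L w₂ k) (trans (sym (decode-encode (L w₁) k))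
                                      (trans (cong (λ e → decode e k) Lk₁≡Lk₂) (decode-encode (L w₂) k))) ⟩
      L w₂ k + - L w₂ k          ≡⟨ FR.-‿inverseʳ _ ⟩
      0#                          ∎

  -- Dirichlet's approximation

  FracVanishes : ℕ → K → Set
  FracVanishes T y = ∀ (j : Fin T) → coeff y -[1+ Fin.toℕ j ] ≡ 0#

  toK-tabulate-minus : ∀ {d} (w w' : Fin d → F) →
    toK (tabulate (λ l → w l + - w' l)) ≈K (toK (tabulate w) -K toK (tabulate w'))
  toK-tabulate-minus w w' (+ j) = begin
    coeff (toK (tabulate (λ l → w l + - w' l))) (+ j)
      ≡⟨ coeff-toK-nonneg (tabulate (λ l → w l + - w' l)) j ⟩
    polyCoeff (tabulate (λ l → w l + - w' l)) j
      ≡⟨ polyCoeff-minus w w' j ⟩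
    polyCoeff (tabulate w) j + - polyCoeff (tabulate w') j
      ≡⟨ cong₂ (λ a b → a + - b) (coeff-toK-nonneg (tabulate w) j) (coeff-toK-nonneg (tabulate w') j) ⟨
    coeff (toK (tabulate w)) (+ j) + - coeff (toK (tabulate w')) (+ j)
      ≡⟨ coeff-minus (toK (tabulate w)) (toK (tabulate w')) (+ j) ⟨
    coeff (toK (tabulate w) -K toK (tabulate w')) (+ j) ∎
    where
    polyCoeff-minus : ∀ {d} (w w' : Fin d → F) j →
      polyCoeff (tabulate (λ l → w l + - w' l)) j ≡ polyCoeff (tabulate w) j + - polyCoeff (tabulate w') j
    polyCoeff-minus {zero}  w w' j       = 0≡0-0
    polyCoeff-minus {suc d} w w' zero    = refl
    polyCoeff-minus {suc d} w w' (suc j) = polyCoeff-minus (w ∘ Fin.suc) (w' ∘ Fin.suc) j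
  toK-tabulate-minus w w' -[1+ j ] = begin
    coeff (toK (tabulate (λ l → w l + - w' l))) -[1+ j ]
      ≡⟨ coeff-toK-neg (tabulate (λ l → w l + - w' l)) j ⟩
    0#
      ≡⟨ 0≡0-0 ⟩
    0# + - 0#
      ≡⟨ cong₂ (λ a b → a + - b) (coeff-toK-neg (tabulate w) j) (coeff-toK-neg (tabulate w') j) ⟨
    coeff (toK (tabulate w)) -[1+ j ] + - coeff (toK (tabulate w')) -[1+ j ]
      ≡⟨ coeff-minus (toK (tabulate w)) (toK (tabulate w')) -[1+ j ] ⟨
    coeff (toK (tabulate w) -K toK (tabulate w')) -[1+ j ] ∎

  FracVanishes-near-poly : ∀ {T y} p → DegreeAtMost (toK p -K y) -[1+ T ] → FracVanishes T y
  FracVanishes-near-poly {y = y} p p-y≤ j = sym (x∙y⁻¹≈ε⇒x≈y 0# (coeff y κ) (begin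
    0# + - coeff y κ              ≡⟨ cong (λ z → z + - coeff y κ) (coeff-toK-neg p (Fin.toℕ j)) ⟨
    coeff (toK p) κ + - coeff y κ ≡⟨ coeff-minus (toK p) y κ ⟨
    coeff (toK p -K y) κ          ≡⟨ p-y≤ κ (ℤ.-<- (FinP.toℕ<n j)) ⟩
    0#                            ∎))
    where
    κ : ℤ
    κ = -[1+ Fin.toℕ j ]

  DegreeAtMost-truncate-minus : ∀ {y T} P → DegreeAtMost y (+ P) → FracVanishes T y →
    DegreeAtMost (toK (truncate (suc P) y) -K y) -[1+ T ]
  DegreeAtMost-truncate-minus {y} P y≤P frac≡0 (+ j) _ = begin
    coeff (toK (truncate (suc P) y) -K y) (+ j)         ≡⟨ coeff-minus (toK (truncate (suc P) y)) y (+ j) ⟩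
    coeff (toK (truncate (suc P) y)) (+ j) + - coeff y (+ j)
      ≡⟨ cong (λ z → z + - coeff y (+ j)) (coeff-truncate (suc P) y≤P (ℤ.+<+ (ℕP.n<1+n P)) j) ⟩
    coeff y (+ j) + - coeff y (+ j)                     ≡⟨ FR.-‿inverseʳ _ ⟩
    0#                                                  ∎
  DegreeAtMost-truncate-minus {y} P y≤P frac≡0 -[1+ j ] (ℤ.-<- j<T) = begin
    coeff (toK (truncate (suc P) y) -K y) -[1+ j ]      ≡⟨ coeff-minus (toK (truncate (suc P) y)) y -[1+ j ] ⟩
    coeff (toK (truncate (suc P) y)) -[1+ j ] + - coeff y -[1+ j ]
      ≡⟨ cong₂ (λ a b → a + - b) (coeff-toK-neg (truncate (suc P) y) j)
                                 (trans (cong (λ i → coeff y -[1+ i ]) (sym (FinP.toℕ-fromℕ< j<T)))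
                                        (frac≡0 (Fin.fromℕ< j<T))) ⟩
    0# + - 0#                                           ≡⟨ 0≡0-0 ⟨
    0#                                                  ∎

  module Dirichlet {n} (T : ℕ) (x : Fin n → K) where

    IsSolution : ∀ {d} → (Fin d → F) → Set
    IsSolution w = ¬ (∀ l → w l ≡ 0#) × ∀ i → FracVanishes T (toK (tabulate w) *K x i)

    Solution : ℕ → Set
    Solution d = ∃ λ (w : Fin d → F) → IsSolution w

    IsSolution-cong : ∀ {d} {w w' : Fin d → F} → w ≗ w' → IsSolution w → IsSolution w'
    IsSolution-cong w≗w' (w≢0 , vanishes) =
      (λ w'≡0 → w≢0 λ l → trans (w≗w' l) (w'≡0 l)) ,
      subst (λ p → ∀ i → FracVanishes T (toK p *K x i)) (ListP.tabulate-cong w≗w') vanishes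

    isSolution? : ∀ {d} (w : Fin d → F) → Dec (IsSolution w)
    isSolution? w = ¬? (FinP.all? λ l → w l ≟F 0#) ×-dec
                    FinP.all? λ i → FinP.all? λ j → coeff (toK (tabulate w) *K x i) -[1+ Fin.toℕ j ] ≟F 0#

    solution? : ∀ d → Dec (Solution d)
    solution? d with FinP.any? (λ (k : Fin (q ℕ.^ d)) → isSolution? (decode k))
    ... | yes (k , sol) = yes (decode k , sol)
    ... | no  ¬sol      = no λ (w , sol) → ¬sol (encode w , IsSolution-cong (sym ∘ decode-encode w) sol)

    fracCoeff : ∀ {d} → (Fin d → F) → Fin (n ℕ.* T) → F
    fracCoeff w k with Fin.remQuot {n} T k
    ... | i , j = coeff (toK (tabulate w) *K x i) -[1+ Fin.toℕ j ]

    fracCoeff-minus : ∀ {d} (w w' : Fin d → F) k →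
      fracCoeff (λ l → w l + - w' l) k ≡ fracCoeff w k + - fracCoeff w' k
    fracCoeff-minus w w' k = begin
      coeff (toK (tabulate (λ l → w l + - w' l)) *K xᵢ) κ
        ≡⟨ *K-cong (toK-tabulate-minus w w') (≈K-refl {xᵢ}) κ ⟩
      coeff ((toK (tabulate w) -K toK (tabulate w')) *K xᵢ) κ
        ≡⟨ *K-distribʳ--K xᵢ (toK (tabulate w)) (toK (tabulate w')) κ ⟩
      coeff ((toK (tabulate w) *K xᵢ) -K (toK (tabulate w') *K xᵢ)) κ
        ≡⟨ coeff-minus (toK (tabulate w) *K xᵢ) (toK (tabulate w') *K xᵢ) κ ⟩
      fracCoeff w k + - fracCoeff w' k ∎
      where
      xᵢ : K
      xᵢ = x (proj₁ (Fin.remQuot {n} T k))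
      κ : ℤ
      κ = -[1+ Fin.toℕ (proj₂ (Fin.remQuot {n} T k)) ]

    solution-exists : Solution (suc (n ℕ.* T))
    solution-exists = w , w≢0 , vanishes
      where
      kernel : ∃ λ w → ¬ (∀ l → w l ≡ 0#) × ∀ k → fracCoeff w k ≡ 0#
      kernel = kernel-nontrivial (ℕP.n<1+n (n ℕ.* T)) fracCoeff fracCoeff-minus
      w : Fin (suc (n ℕ.* T)) → F
      w = proj₁ kernel
      w≢0 : ¬ (∀ l → w l ≡ 0#)
      w≢0 = proj₁ (proj₂ kernel)
      vanishes : ∀ i → FracVanishes T (toK (tabulate w) *K x i)
      vanishes i j = trans (cong (λ (i , j) → coeff (toK (tabulate w) *K x i) -[1+ Fin.toℕ j ])
                                 (sym (FinP.remQuot-combine i j)))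
                           (proj₂ (proj₂ kernel) (Fin.combine i j))

    least-solution : ∃ λ d → d ℕ.≤ n ℕ.* T × Solution (suc d) × ¬ Solution d
    least-solution = from-least (least-witness solution? solution-exists)
      where
      from-least : (∃ λ d → d ℕ.≤ suc (n ℕ.* T) × Solution d × (∀ d' → d' ℕ.< d → ¬ Solution d')) →
        ∃ λ d → d ℕ.≤ n ℕ.* T × Solution (suc d) × ¬ Solution d
      from-least (zero  , _       , (w , w≢0 , _) , _)     = ⊥-elim (w≢0 λ ())
      from-least (suc d , d<1+P , sol , below) = d , ℕP.≤-pred d<1+P , sol , below d (ℕP.n<1+n d)

private
  lower-exponent : ∀ n t M →
    + (2 ℕ.* n ℕ.* n ℕ.* t) ℤ.- + M ≡ ℤ.- (+ M) ℤ.- + (2 ℕ.* n) ℤ.* ℤ.- (+ (n ℕ.* t))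
  lower-exponent n t M = trans (cong (ℤ._- + M) (2n*nt n t)) (ab-M≡-M-a*-b (+ (2 ℕ.* n)) (+ (n ℕ.* t)) (+ M))
    where
    ab-M≡-M-a*-b : ∀ (a b M : ℤ) → a ℤ.* b ℤ.- M ≡ ℤ.- M ℤ.- a ℤ.* ℤ.- b
    ab-M≡-M-a*-b = solve-∀

  -M≰2n*-[1+M] : ∀ {n} M → 1 ℕ.≤ n → ¬ (ℤ.- (+ M) ℤ.≤ + (2 ℕ.* n) ℤ.* -[1+ M ])
  -M≰2n*-[1+M] {suc n} zero    _ ()
  -M≰2n*-[1+M] {suc n} (suc M) _ (ℤ.-≤- M+k≤M) = ℕP.<⇒≱ (ℕP.m≤m+n (suc M) _) M+k≤M

  t+-[1+t+M]≡-[1+M] : ∀ t M → + t ℤ.+ -[1+ t ℕ.+ M ] ≡ -[1+ M ]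
  t+-[1+t+M]≡-[1+M] zero    M = refl
  t+-[1+t+M]≡-[1+M] (suc t) M = trans (ℤP.[1+m]⊖[1+n]≡m⊖n t (suc (t ℕ.+ M))) (t+-[1+t+M]≡-[1+M] t M)

  closeness-exponent : ∀ {n} t M D → 1 ℕ.≤ n →
    + (2 ℕ.* n ℕ.* n ℕ.* t) ℤ.- + M ℤ.≤ + (2 ℕ.* n) ℤ.* D →
    ℤ.- D ℤ.+ -[1+ t ℕ.+ M ] ℤ.< ℤ.- (+ ((n ℕ.+ 1) ℕ.* t))
  closeness-exponent {n@(suc _)} t M D _ lower = ℤP.suc[i]≤j⇒i<j (begin
    + 1 ℤ.+ (ℤ.- D ℤ.+ -[1+ t ℕ.+ M ])  ≡⟨ 1+[-D-[1+t+M]]≡-[D+M+t] D (+ t) (+ M) ⟩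
    ℤ.- (D ℤ.+ + M ℤ.+ + t)             ≤⟨ ℤP.neg-mono-≤ (ℤP.+-monoˡ-≤ (+ t) nt≤D+M) ⟩
    ℤ.- (+ (n ℕ.* t) ℤ.+ + t)           ≡⟨ cong ℤ.-_ nt+t≡[n+1]t ⟩
    ℤ.- (+ ((n ℕ.+ 1) ℕ.* t))           ∎)
    where
    open ℤP.≤-Reasoning
    1+[-D-[1+t+M]]≡-[D+M+t] : ∀ (D t M : ℤ) →
      + 1 ℤ.+ (ℤ.- D ℤ.+ ℤ.- (+ 1 ℤ.+ (t ℤ.+ M))) ≡ ℤ.- (D ℤ.+ M ℤ.+ t)
    1+[-D-[1+t+M]]≡-[D+M+t] = solve-∀
    nt+t≡[n+1]t : + (n ℕ.* t) ℤ.+ + t ≡ + ((n ℕ.+ 1) ℕ.* t)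
    nt+t≡[n+1]t = trans (sym (ℤP.pos-+ (n ℕ.* t) t))
      (cong +_ (trans (cong (n ℕ.* t ℕ.+_) (sym (ℕP.*-identityˡ t))) (sym (ℕP.*-distribʳ-+ t n 1))))
    nt≤D+M : + (n ℕ.* t) ℤ.≤ D ℤ.+ + M
    nt≤D+M = ℤP.*-cancelˡ-≤-pos (+ (n ℕ.* t)) (D ℤ.+ + M) (+ (2 ℕ.* n)) (begin
      + (2 ℕ.* n) ℤ.* + (n ℕ.* t)           ≡⟨ 2n*nt n t ⟨
      + (2 ℕ.* n ℕ.* n ℕ.* t)               ≡⟨ [a-b]+b≡a _ (+ M) ⟨
      + (2 ℕ.* n ℕ.* n ℕ.* t) ℤ.- + M ℤ.+ + M ≤⟨ ℤP.+-monoˡ-≤ (+ M) lower ⟩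
      + (2 ℕ.* n) ℤ.* D ℤ.+ + M             ≤⟨ ℤP.+-monoʳ-≤ (+ (2 ℕ.* n) ℤ.* D)
                                                 (ℤP.≤-trans (ℤ.+≤+ (ℕP.m≤n*m M (2 ℕ.* n)))
                                                             (ℤP.≤-reflexive (ℤP.pos-* (2 ℕ.* n) M))) ⟩
      + (2 ℕ.* n) ℤ.* D ℤ.+ + (2 ℕ.* n) ℤ.* + M ≡⟨ ℤP.*-distribˡ-+ (+ (2 ℕ.* n)) D (+ M) ⟨
      + (2 ℕ.* n) ℤ.* (D ℤ.+ + M)           ∎)

module Approximation (𝔽 : FiniteField) {n t M : ℕ} (x : Fin n → Over.K 𝔽)
  (|x|≤1 : ∀ i → Laurent.DegreeAtMost 𝔽 (x i) (+ 0)) where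
  open FiniteField 𝔽 using (F; 0#; _≟F_)
  open Over 𝔽
  open Laurent 𝔽
  open import Relation.Binary.Reasoning.Setoid ≈K-setoid

  T P : ℕ
  T = t ℕ.+ M
  P = n ℕ.* T

  open Dirichlet T x

  module Approximant {d} (d≤P : d ℕ.≤ P) (w : Fin (suc d) → F) (w-sol : IsSolution w)
                     (no-smaller : ¬ Solution d) where

    g : Poly
    g = tabulate w

    f : Fin n → Poly
    f i = truncate (suc P) (toK g *K x i)

    error : Fin n → K
    error i = toK (f i) -K (x i *K toK g)

    g≉0 : ¬ (toK g ≈K 0K)
    g≉0 = toK-tabulate-≉0K w (proj₁ w-sol)

    deg-g : DegreeAtMost (toK g) (+ d)
    deg-g = DegreeAtMost-tabulate w

    deg-f : ∀ i → DegreeAtMost (toK (f i)) (+ P)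
    deg-f i = DegreeAtMost-tabulate (λ l → coeff (toK g *K x i) (+ Fin.toℕ l))

    deg-error : ∀ i → DegreeAtMost (error i) -[1+ T ]
    deg-error i = DegreeAtMost-≈K (+K-cong ≈K-refl (-K-cong (*K-comm (toK g) (x i))))
      (DegreeAtMost-truncate-minus P deg-gx (proj₂ w-sol i))
      where
      deg-gx : DegreeAtMost (toK g *K x i) (+ P)
      deg-gx = DegreeAtMost-mono (ℤP.≤-trans (ℤP.≤-reflexive (ℤP.+-identityʳ (+ d))) (ℤ.+≤+ d≤P))
                 (DegreeAtMost-*K deg-g (|x|≤1 i))

    cofactor-vanishes : ∀ {h kq D} → (toK kq *K toK h) ≈K toK g → (∀ i → h ∣P f i) →
      + 0 ℤ.≤ D → coeff (toK h) D ≢ 0# → DegreeAtMost (toK h) D → ∀ i → FracVanishes T (x i *K toK kq)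
    cofactor-vanishes {h} {kq} kq*h≈g h∣f 0≤D h_D≢0 deg-h i =
      FracVanishes-near-poly kᵢ (DegreeAtMost-mono (ℤP.+-monoˡ-≤ -[1+ T ] (ℤP.neg-mono-≤ 0≤D))
        (DegreeAtMost-cancelˡ deg-h h_D≢0 (DegreeAtMost-≈K (≈K-sym h*[kᵢ-x*kq]≈error) (deg-error i))))
      where
      kᵢ : Poly
      kᵢ = proj₁ (h∣f i)
      h*[kᵢ-x*kq]≈error : (toK h *K (toK kᵢ -K (x i *K toK kq))) ≈K error i
      h*[kᵢ-x*kq]≈error = begin
        toK h *K (toK kᵢ -K (x i *K toK kq))
          ≈⟨ *K-distribˡ--K (toK h) (toK kᵢ) (x i *K toK kq) ⟩
        (toK h *K toK kᵢ) -K (toK h *K (x i *K toK kq))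
          ≈⟨ +K-cong (≈K-trans (*K-comm (toK h) (toK kᵢ)) (proj₂ (h∣f i))) (-K-cong (begin
               toK h *K (x i *K toK kq)   ≈⟨ *K-comm (toK h) (x i *K toK kq) ⟩
               (x i *K toK kq) *K toK h   ≈⟨ *K-assoc (x i) (toK kq) (toK h) ⟩
               x i *K (toK kq *K toK h)   ≈⟨ *K-cong (≈K-refl {x i}) kq*h≈g ⟩
               x i *K toK g               ∎)) ⟩
        error i ∎

    cofactor-solution : ∀ {h kq D} → (toK kq *K toK h) ≈K toK g → (∀ i → h ∣P f i) →
      + 0 ℤ.< D → coeff (toK h) D ≢ 0# → DegreeAtMost (toK h) D → Solution d
    cofactor-solution {h} {kq} {D} kq*h≈g h∣f 0<D h_D≢0 deg-h = w' , w'≢0 , w'-vanishes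
      where
      deg-kq : DegreeAtMost (toK kq) (ℤ.- D ℤ.+ + d)
      deg-kq = DegreeAtMost-cancelˡ deg-h h_D≢0
        (DegreeAtMost-≈K (≈K-sym (≈K-trans (*K-comm (toK h) (toK kq)) kq*h≈g)) deg-g)
      w' : Fin d → F
      w' l = coeff (toK kq) (+ Fin.toℕ l)
      w'≈kq : toK (tabulate w') ≈K toK kq
      w'≈kq = truncate-≈K d deg-kq (ℤP.+-monoˡ-< (+ d) (ℤP.neg-mono-< 0<D))
      w'≢0 : ¬ (∀ l → w' l ≡ 0#)
      w'≢0 w'≡0 = g≉0 (begin
        toK g             ≈⟨ kq*h≈g ⟨
        toK kq *K toK h   ≈⟨ *K-cong (≈K-trans (≈K-sym w'≈kq) (toK-tabulate-≈0K w' w'≡0))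
                                     (≈K-refl {toK h}) ⟩
        0K *K toK h       ≈⟨ *K-zeroˡ (toK h) ⟩
        0K                ∎)
      w'-vanishes : ∀ i → FracVanishes T (toK (tabulate w') *K x i)
      w'-vanishes i j = trans
        (≈K-trans (*K-cong w'≈kq (≈K-refl {x i})) (*K-comm (toK kq) (x i)) -[1+ Fin.toℕ j ])
        (cofactor-vanishes {h} {kq} kq*h≈g h∣f (ℤP.<⇒≤ 0<D) h_D≢0 deg-h i j)

    coprime : ∀ h → h ∣P g → (∀ i → h ∣P f i) → AbsLe (toK h) (+ 0) (+ 1)
    coprime h (kq , kq*h≈g) h∣f k 0<1*k with coeff (toK h) k ≟F 0#
    ... | yes h_k≡0 = h_k≡0
    ... | no  h_k≢0 = ⊥-elim (no-smaller (cofactor-solution {h} {kq} kq*h≈g h∣f 0<D h_D≢0 deg-h))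
      where
      leading : ∃ λ D → k ℤ.≤ D × coeff (toK h) D ≢ 0# × DegreeAtMost (toK h) D
      leading = leading-coeff (DegreeAtMost-toK h) h_k≢0
      D : ℤ
      D = proj₁ leading
      0<D : + 0 ℤ.< D
      0<D = ℤP.<-≤-trans (subst (+ 0 ℤ.<_) (ℤP.*-identityˡ k) 0<1*k) (proj₁ (proj₂ leading))
      h_D≢0 : coeff (toK h) D ≢ 0#
      h_D≢0 = proj₁ (proj₂ (proj₂ leading))
      deg-h : DegreeAtMost (toK h) D
      deg-h = proj₂ (proj₂ (proj₂ leading))

    approximant : Fin (suc n) → Poly
    approximant Fin.zero    = g
    approximant (Fin.suc i) = f i

    approximant≉0 : ¬ (∀ i → latticeVec n t x approximant i ≈K 0K)
    approximant≉0 all≈0 = Xpow-*K-≉0K (ℤ.- (+ (n ℕ.* t))) g≉0 (all≈0 Fin.zero)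

    deg-latticeVec-suc : ∀ i → DegreeAtMost (latticeVec n t x approximant (Fin.suc i)) -[1+ M ]
    deg-latticeVec-suc i = subst (DegreeAtMost (latticeVec n t x approximant (Fin.suc i)))
      (t+-[1+t+M]≡-[1+M] t M) (DegreeAtMost-*K (DegreeAtMost-Xpow (+ t)) (deg-error i))

    module Bounds (1≤n : 1 ℕ.≤ n)
      (hyp : ∀ (p : Fin (suc n) → Poly) → ¬ (∀ i → latticeVec n t x p i ≈K 0K) →
             ∃ λ i → AbsGe (latticeVec n t x p i) (ℤ.- (+ M)) (+ (2 ℕ.* n))) where

      g-large : AbsGe (toK g) (+ (2 ℕ.* n ℕ.* n ℕ.* t) ℤ.- + M) (+ (2 ℕ.* n))
      g-large = from-hyp (hyp approximant approximant≉0)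
        where
        from-hyp : (∃ λ i → AbsGe (latticeVec n t x approximant i) (ℤ.- (+ M)) (+ (2 ℕ.* n))) →
          AbsGe (toK g) (+ (2 ℕ.* n ℕ.* n ℕ.* t) ℤ.- + M) (+ (2 ℕ.* n))
        from-hyp (Fin.zero  , large) = AbsGe-weaken {den = + (2 ℕ.* n)} (ℤP.≤-reflexive (lower-exponent n t M))
                                         (AbsGe-Xpow-*K {den = + (2 ℕ.* n)} large)
        from-hyp (Fin.suc i , large) = ⊥-elim (-M≰2n*-[1+M] M 1≤n
                                         (AbsGe⇒≤*degree {den = 2 ℕ.* n} (deg-latticeVec-suc i) large))

      leading : ∃ λ D → proj₁ g-large ℤ.≤ D × coeff (toK g) D ≢ 0# × DegreeAtMost (toK g) D
      leading = leading-coeff deg-g (proj₁ (proj₂ g-large))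

      D : ℤ
      D = proj₁ leading

      g-deg-D : DegreeAtMost (toK g) D
      g-deg-D = proj₂ (proj₂ (proj₂ leading))

      inverse-g : ∃ λ u → DegreeAtMost u (ℤ.- D) × (toK g *K u) ≈K 1K
      inverse-g = *K-inverse g-deg-D (proj₁ (proj₂ (proj₂ leading)))

      u : K
      u = proj₁ inverse-g

      deg-u : DegreeAtMost u (ℤ.- D)
      deg-u = proj₁ (proj₂ inverse-g)

      g*u≈1 : (toK g *K u) ≈K 1K
      g*u≈1 = proj₂ (proj₂ inverse-g)

      v : Fin n → K
      v i = u *K toK (f i)

      g*v≈f : ∀ i → (toK g *K v i) ≈K toK (f i)
      g*v≈f i = begin
        toK g *K (u *K toK (f i))    ≈⟨ *K-assoc (toK g) u (toK (f i)) ⟨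
        (toK g *K u) *K toK (f i)    ≈⟨ *K-cong g*u≈1 (≈K-refl {toK (f i)}) ⟩
        1K *K toK (f i)              ≈⟨ *K-identityˡ (toK (f i)) ⟩
        toK (f i)                    ∎

      x-v≈-u*error : ∀ i → (x i -K v i) ≈K (-K (u *K error i))
      x-v≈-u*error i = begin
        x i -K v i
          ≈⟨ -K-anti-homo-minus (v i) (x i) ⟨
        -K (v i -K x i)
          ≈⟨ -K-cong (+K-cong (≈K-refl {v i}) (-K-cong u*xg≈x)) ⟨
        -K ((u *K toK (f i)) -K (u *K (x i *K toK g)))
          ≈⟨ -K-cong (*K-distribˡ--K u (toK (f i)) (x i *K toK g)) ⟨
        -K (u *K error i) ∎
        where
        u*xg≈x : (u *K (x i *K toK g)) ≈K x i
        u*xg≈x = ≈K-trans (*K-cong (≈K-refl {u}) (*K-comm (x i) (toK g)))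
                          (*K-cancelˡ {toK g} {u} (x i) g*u≈1)

      close : ∀ i → AbsLeHalfExp (x i -K v i) (ℤ.- (+ ((n ℕ.+ 1) ℕ.* t)))
      close i = DegreeAtMost⇒AbsLeHalfExp
        (DegreeAtMost-≈K (≈K-sym (x-v≈-u*error i)) (DegreeAtMost--K (DegreeAtMost-*K deg-u (deg-error i))))
        (closeness-exponent t M D 1≤n (AbsGe⇒≤*degree {den = 2 ℕ.* n} g-deg-D g-large))

-- Imported only here since inside Laurent, _+_ and _*_ are the operations of 𝔽.
open import Data.Nat using (_≤_; _*_; _+_)

lemma3p4 : (𝔽 : FiniteField) → let open Over 𝔽 in
    (n t M : ℕ) → 1 ≤ n → 1 ≤ t → 2 * n ≤ M →
    (x : Fin n → K) →
    (∀ i → AbsLe (x i) (+ 0) (+ 1)) →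
    (∀ (p : Fin (suc n) → Poly) →
       ¬ (∀ i → latticeVec n t x p i ≈K 0K) →
       ∃ λ i → AbsGe (latticeVec n t x p i) (ℤ.- (+ M)) (+ (2 * n))) →
    ∃ λ (g : Poly) → ∃ λ (f : Fin n → Poly) → ∃ λ (v : Fin n → K) →
      (¬ (toK g ≈K 0K)) ×
      (∀ h → h ∣P g → (∀ i → h ∣P f i) → AbsLe (toK h) (+ 0) (+ 1)) ×
      (∀ i → (toK g *K v i) ≈K toK (f i)) ×
      ((AbsGe (toK g) (+ (2 * n * n * t) ℤ.- + M) (+ (2 * n))
        ⊎ ∃ λ i → AbsGe (toK (f i)) (+ (2 * n * n * t) ℤ.- + M) (+ (2 * n)))) ×
      (AbsLe (toK g) (+ (n * (t + M))) (+ 1)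
        × (∀ i → AbsLe (toK (f i)) (+ (n * (t + M))) (+ 1))) ×
      (∀ i → AbsLeHalfExp (x i -K v i) (ℤ.- (+ ((n + 1) * t))))
lemma3p4 𝔽 n t M 1≤n _ _ x |x|≤1 hyp =
  let open Laurent 𝔽
      (d , d≤P , (w , w-sol) , no-smaller) = Dirichlet.least-solution (t + M) x
      open Approximation 𝔽 {n} {t} {M} x (AbsLe⇒DegreeAtMost ∘ |x|≤1)
      open Approximant d≤P w w-sol no-smaller
      open Bounds 1≤n hyp
  in g , f , v , g≉0 , coprime , g*v≈f , inj₁ g-large ,
     (DegreeAtMost⇒AbsLe (DegreeAtMost-mono (ℤ.+≤+ d≤P) deg-g) , DegreeAtMost⇒AbsLe ∘ deg-f) ,
     close
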